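{- For every lattice triangle $ABC$, $$\overline{\angle CAB}+_{\operatorname{l\ell}(AB)-\operatorname{l\ell}_1(AB;C)-1}\overline{\angle ABC}+_{\operatorname{l\ell}(BC)-\operatorname{l\ell}_1(BC;A)-1}\overline{\angle BCA}=\pi.$$
   Context: We work in $\mathbb R^2$ with standard orientation and lattice $\mathbb Z^2$, origin $O$. A lattice-affine transformation is $x\mapsto Mx+b$, $M\in GL_2(\mathbb Z)$, $b\in\mathbb Z^2$; proper if $\det M=1$. $\operatorname{l\ell}(AB)$ is the number of lattice points on segment $AB$ minus one. A lattice point $P$ is at lattice distance $k$ from lattice segment $AB$ if the primitive vector along $AB$ and $P-A$ generate a sublattice of index $k$ in $\mathbb Z^2$. For a lattice triangle $ABC$, $\operatorname{l\ell}_1(AB;C)$ is the number of lattice points at lattice distance $1$ from segment $AB$ lying in the closed triangle $ABC$. An ordinary lattice angle $\angle XYZ$ is the ordered pair (ray $YX$, ray $YZ$), lattice points not collinear. Lattice sine/tangent: let $v_1,v_2$ be primitive lattice vectors along $YX$, $YZ$; lattice points $P$ with $(v_1,P-Y)$ a basis form two lines parallel to $YX$; ray $YZ$ meets exactly one, $l$, at $Q$; $D$ is the lattice point of $l$ nearest $Q$ among those strictly on the other side of line $YZ$ from $X$; writing $v_2=x_1v_1+x_2(D-Y)$, $\operatorname{lsin}\angle XYZ=x_2$, $\operatorname{ltan}\angle XYZ=x_2/x_1\ge1$. If $X,Y,Z$ are collinear put $\operatorname{lsin}\angle XYZ=0$. Broken lines: $\operatorname{sgn}(A,B,C)$ is the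 sign of $\det(A-B,C-B)$. A lattice oriented broken line $A_0\dots A_N$ ($N\ge1$) is a sequence of lattice points with $A_{i-1}\ne A_i$ (consecutive segments may be collinear); on unit distance from lattice point $V$ if each primitive vector along $A_{i-1}A_i$ with $V-A_{i-1}$ is a basis of $\mathbb Z^2$. Signed length-sine sequence: $a_{2i-2}=\operatorname{sgn}(A_{i-1},V,A_i)\operatorname{l\ell}(A_{i-1}A_i)$ ($1\le i\le N$), $a_{2i-1}=\operatorname{sgn}(A_{i-1},V,A_i)\operatorname{sgn}(A_i,V,A_{i+1})\operatorname{sgn}(A_{i-1},A_i,A_{i+1})\operatorname{lsin}\angle A_{i-1}A_iA_{i+1}$ ($1\le i\le N-1$). Broken lines on unit distance from $V$ are equivalent if they share first and last vertices and the first followed by the reverse of the second is null-homotopic in $\mathbb R^2\setminus\{V\}$. $(V,l)$ is proper lattice-congruent to $(V',l')$ if a proper lattice-affine map sends $V$ to $V'$ and $l$ to a broken line equivalent to $l'$. Sums: for $k\ge1$, $S_k$ is $k-1$ copies of $(1,-2,1,-2)$ followed by $(1,-2,1)$, and $L_k$ is the broken line on unit distance from $O$ with first vertices $(1,0),(1,1)$ and signed length-sine sequence $S_k$. The sequence of an ordinary lattice angle $\alpha$ is $(c_0,\dots,c_{2r})$ where $\operatorname{ltan}\alpha=[c_0;c_1,\dots,c_{2r}]$ is its odd continued fraction (positive integer terms). For ordinary lattice angles $\beta_1,\dots,\beta_l$ and integers $m_1,\dots,m_{l-1}$, $\bar\beta_1+_{m_1}\cdots+_{m_{l-1}}\bar\beta_l=k\pi$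 means: some broken line $l$ on unit distance from a lattice point $V$ with signed length-sine sequence (sequence of $\beta_1$, $m_1$, sequence of $\beta_2$, $\dots$, $m_{l-1}$, sequence of $\beta_l$) has $(V,l)$ proper lattice-congruent to $(O,L_k)$. -}

module Defs where

open import Data.Nat as ℕ using (ℕ; zero; suc)
import Data.Nat.GCD as ℕG
open import Data.Integer
  using (ℤ; +_; -[1+_]; +0; +[1+_]; _+_; _-_; _*_; -_; ∣_∣; _≤_; _<_; _≤ᵇ_; _⊓_; _⊔_; _/ℕ_; 0ℤ; 1ℤ)
open import Data.Bool using (Bool; true; false; _∧_; _∨_; if_then_else_)
open import Data.List using (List; []; _∷_; _++_; length; map; concatMap; replicate; concat; filterᵇ; head; last; reverse; take)
open import Data.Maybe using (Maybe)
open import Data.Product using (Σ; _×_; _,_; proj₁; proj₂; ∃)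
open import Data.Unit using (⊤)
open import Relation.Binary.PropositionalEquality using (_≡_; _≢_)

Point : Set
Point = ℤ × ℤ

O : Point
O = (0ℤ , 0ℤ)

_⊖_ : Point → Point → Point
(a , b) ⊖ (c , d) = (a - c , b - d)

_⊕_ : Point → Point → Point
(a , b) ⊕ (c , d) = (a + c , b + d)

_·_ : ℤ → Point → Point
k · (a , b) = (k * a , k * b)

det : Point → Point → ℤ
det (a , b) (c , d) = a * d - b * c

normSq : Point → ℤ
normSq (a , b) = a * a + b * b

sgnℤ : ℤ → ℤ
sgnℤ +0 = 0ℤ
sgnℤ +[1+ _ ] = 1ℤ
sgnℤ -[1+ _ ] = - 1ℤ

sgn : Point → Point → Point → ℤ
sgn A B C = sgnℤ (det (A ⊖ B) (C ⊖ B))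

gcdv : Point → ℕ
gcdv (a , b) = ℕG.gcd ∣ a ∣ ∣ b ∣

-- lattice length l\ell(AB): number of lattice points on AB minus one
lℓ : Point → Point → ℕ
lℓ A B = gcdv (B ⊖ A)

divBy : ℕ → Point → Point
divBy zero v = v
divBy (suc k) (a , b) = (a /ℕ suc k , b /ℕ suc k)

prim : Point → Point
prim v = divBy (gcdv v) v

-- lattice distance from P to the lattice segment AB: the index of the
-- sublattice generated by the primitive vector along AB and P - A
-- (the absolute value of their determinant)
latDist : Point → Point → Point → ℕ
latDist A B P = ∣ det (prim (B ⊖ A)) (P ⊖ A) ∣

inTri : Point → Point → Point → Point → Bool
inTri A B C P =
  let d₁ = det (B ⊖ A) (P ⊖ A)
      d₂ = det (C ⊖ B) (P ⊖ B)
      d₃ = det (A ⊖ C) (P ⊖ C)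
  in ((0ℤ ≤ᵇ d₁) ∧ (0ℤ ≤ᵇ d₂) ∧ (0ℤ ≤ᵇ d₃)) ∨ ((d₁ ≤ᵇ 0ℤ) ∧ (d₂ ≤ᵇ 0ℤ) ∧ (d₃ ≤ᵇ 0ℤ))

range : ℤ → ℕ → List ℤ
range lo zero = []
range lo (suc n) = lo ∷ range (lo + 1ℤ) n

box : Point → Point → Point → List Point
box (a₁ , a₂) (b₁ , b₂) (c₁ , c₂) =
  let x₀ = a₁ ⊓ b₁ ⊓ c₁
      x₁ = a₁ ⊔ b₁ ⊔ c₁
      y₀ = a₂ ⊓ b₂ ⊓ c₂
      y₁ = a₂ ⊔ b₂ ⊔ c₂
  in concatMap (λ x → map (λ y → (x , y)) (range y₀ (suc ∣ y₁ - y₀ ∣)))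
               (range x₀ (suc ∣ x₁ - x₀ ∣))

isOne : ℕ → Bool
isOne 1 = true
isOne _ = false

lℓ₁ : Point → Point → Point → ℕ
lℓ₁ A B C = length (filterᵇ (λ P → inTri A B C P ∧ isOne (latDist A B P)) (box A B C))

-- With v₁, v₂ the primitive vectors along YX, YZ, and D as in the
-- definition, v₂ = x₁ v₁ + x₂ (D - Y) forces det(v₁,v₂) = x₂ det(v₁,D-Y)
-- = ± x₂ with x₂ > 0, i.e. lsin = |det(v₁,v₂)|; this is 0 for collinear X,Y,Z.
lsin : Point → Point → Point → ℤ
lsin X Y Z = + ∣ det (prim (X ⊖ Y)) (prim (Z ⊖ Y)) ∣

-- The point D of the definition of lattice sine/tangent of ∠XYZ.
record IsD (X Y Z D : Point) : Set where
  field
    -- D lies on the line l: det(v₁, D - Y) = ε with ε the sign of det(v₁,v₂)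
    -- (the one of the two lines det(v₁,P-Y) = ±1 met by ray YZ, at
    -- Q = Y + v₂ / |det(v₁,v₂)|)
    onL : det (prim (X ⊖ Y)) (D ⊖ Y) ≡ sgnℤ (det (prim (X ⊖ Y)) (prim (Z ⊖ Y)))
    otherSide : det (prim (Z ⊖ Y)) (D ⊖ Y) * det (prim (Z ⊖ Y)) (X ⊖ Y) < 0ℤ
    -- D is nearest to Q among such points; distances are compared via
    -- |n (P - Y) - v₂|² = n² |P - Q|², n = |det(v₁,v₂)|
    nearest : ∀ (P : Point) →
      det (prim (X ⊖ Y)) (P ⊖ Y) ≡ sgnℤ (det (prim (X ⊖ Y)) (prim (Z ⊖ Y))) →
      det (prim (Z ⊖ Y)) (P ⊖ Y) * det (prim (Z ⊖ Y)) (X ⊖ Y) < 0ℤ →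
      normSq (((+ ∣ det (prim (X ⊖ Y)) (prim (Z ⊖ Y)) ∣) · (D ⊖ Y)) ⊖ prim (Z ⊖ Y))
        ≤ normSq (((+ ∣ det (prim (X ⊖ Y)) (prim (Z ⊖ Y)) ∣) · (P ⊖ Y)) ⊖ prim (Z ⊖ Y))

cfEval : List ℤ → ℤ × ℤ
cfEval [] = (1ℤ , 0ℤ)
cfEval (c ∷ cs) with cfEval cs
... | (p , q) = (c * p + q , p)

data AllPos : List ℤ → Set where
  []  : AllPos []
  _∷_ : ∀ {c cs} → 1ℤ ≤ c → AllPos cs → AllPos (c ∷ cs)

record IsOddCF (c : List ℤ) (num den : ℤ) : Set where
  field
    oddLength : Σ ℕ (λ r → length c ≡ suc (2 ℕ.* r))
    positive  : AllPos c
    value     : proj₁ (cfEval c) * den ≡ num * proj₂ (cfEval c)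

-- c is the sequence of the ordinary lattice angle ∠XYZ:
-- ltan ∠XYZ = x₂ / x₁ where v₂ = x₁ v₁ + x₂ (D - Y), and c is its odd continued fraction
AngleSeq : Point → Point → Point → List ℤ → Set
AngleSeq X Y Z c =
  Σ Point λ D → Σ ℤ λ x₁ → Σ ℤ λ x₂ →
    IsD X Y Z D ×
    prim (Z ⊖ Y) ≡ ((x₁ · prim (X ⊖ Y)) ⊕ (x₂ · (D ⊖ Y))) ×
    IsOddCF c x₂ x₁

ConsecDistinct : List Point → Set
ConsecDistinct (a ∷ b ∷ rest) = (a ≢ b) × ConsecDistinct (b ∷ rest)
ConsecDistinct _ = ⊤

-- each primitive vector along A_{i-1}A_i together with V - A_{i-1} is a basis
UnitDist : Point → List Point → Set
UnitDist V (a ∷ b ∷ rest) = (∣ det (prim (b ⊖ a)) (V ⊖ a) ∣ ≡ 1) × UnitDist V (b ∷ rest)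
UnitDist V _ = ⊤

IsBrokenLine : Point → List Point → Set
IsBrokenLine V l = (2 ℕ.≤ length l) × ConsecDistinct l × UnitDist V l

lsSeq : Point → List Point → List ℤ
lsSeq V (a ∷ b ∷ []) = sgn a V b * + lℓ a b ∷ []
lsSeq V (a ∷ b ∷ c ∷ rest) =
  sgn a V b * + lℓ a b ∷
  (sgn a V b * sgn b V c * sgn a b c * lsin a b c) ∷
  lsSeq V (b ∷ c ∷ rest)
lsSeq V _ = []

-- winding-number contribution of the edge P→Q around V (crossing rule
-- for the horizontal ray from V; exact since V is not on the edge)
crossing : Point → Point → Point → ℤ
crossing V P Q with P ⊖ V | Q ⊖ V
... | (p₁ , p₂) | (q₁ , q₂) =
  if p₂ ≤ᵇ 0ℤ
  then (if (1ℤ ≤ᵇ q₂) ∧ (1ℤ ≤ᵇ det (p₁ , p₂) (q₁ , q₂)) then 1ℤ else 0ℤ)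
  else (if (q₂ ≤ᵇ 0ℤ) ∧ (det (p₁ , p₂) (q₁ , q₂) ≤ᵇ - 1ℤ) then - 1ℤ else 0ℤ)

wind : Point → List Point → ℤ
wind V (a ∷ b ∷ rest) = crossing V a b + wind V (b ∷ rest)
wind V _ = 0ℤ

-- equivalence of broken lines on unit distance from V: same first and last
-- vertices, and l₁ followed by the reverse of l₂ is null-homotopic in
-- ℝ² ∖ {V} (i.e. has winding number 0 around V)
Equiv : Point → List Point → List Point → Set
Equiv V l₁ l₂ = (head l₁ ≡ head l₂) × (last l₁ ≡ last l₂) × (wind V (l₁ ++ reverse l₂) ≡ 0ℤ)

record ProperAff : Set where
  field
    a b c d t₁ t₂ : ℤ
    detOne : a * d - b * c ≡ 1ℤ

applyAff : ProperAff → Point → Point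
applyAff f (x , y) = (a * x + b * y + t₁ , c * x + d * y + t₂)
  where open ProperAff f

ProperCongruent : Point → List Point → Point → List Point → Set
ProperCongruent V l V' l' =
  Σ ProperAff λ f → (applyAff f V ≡ V') × Equiv V' (map (applyAff f) l) l'

Sseq : ℕ → List ℤ
Sseq k = concat (replicate (k ℕ.∸ 1) (1ℤ ∷ - (+ 2) ∷ 1ℤ ∷ - (+ 2) ∷ [])) ++ (1ℤ ∷ - (+ 2) ∷ 1ℤ ∷ [])

IsL : ℕ → List Point → Set
IsL k L = IsBrokenLine O L × (take 2 L ≡ (1ℤ , 0ℤ) ∷ (1ℤ , 1ℤ) ∷ []) × (lsSeq O L ≡ Sseq k)

-- "β̄₁ +_{m₁} ⋯ = kπ", given the concatenated sequence
-- (seq β₁, m₁, seq β₂, …, m_{l-1}, seq β_l)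
SumIsKπ : List ℤ → ℕ → Set
SumIsKπ s k =
  Σ Point λ V → Σ (List Point) λ l →
    IsBrokenLine V l × (lsSeq V l ≡ s) ×
    Σ (List Point) λ L → IsL k L × ProperCongruent V l O L

sum3 : List ℤ → ℤ → List ℤ → ℤ → List ℤ → List ℤ
sum3 c₁ m₁ c₂ m₂ c₃ = c₁ ++ (m₁ ∷ c₂ ++ (m₂ ∷ c₃))

{-# OPTIONS --safe #-}
-- A sequence (a₀ , b₀ , a₁ , … , a_r) generates from a lattice basis (P , f) the broken line with vertices
-- P, P + a₀ f, …, turning the edge direction f into f + bᵢ Pᵢ₊₁ at each inner vertex Pᵢ₊₁; when the aᵢ are
-- positive its edges are at unit distance from O and its signed length-sine sequence is the given one. For
-- the sequence c of an angle ∠XYZ and the basis (e₁ , e₂) this is the sail of the angle from e₁ to (q , p),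
-- p / q = ltan ∠XYZ, and the angle itself is this picture in a lattice basis (prim (X ⊖ Y) , D ⊖ Y).
-- Generating from the basis of ∠CAB with c₁, m₁, c₂, m₂, c₃ therefore runs along the sail of ∠CAB, the
-- negated sail of ∠ABC and the sail of ∠BCA: counting the lattice points at distance one from a side shows
-- that mᵢ = lℓ - lℓ₁ - 1 is exactly the turn joining consecutive sails. The line goes from the direction of
-- AC to the opposite one, strictly on the side of B; in the basis of ∠CAB it runs from e₁ to -e₁ through the
-- upper half-plane, hence is equivalent to L₁.
module Submission where

open import Defs
open import Data.Nat as ℕ using (ℕ; zero; suc)
import Data.Nat.Properties as ℕP
import Data.Nat.GCD as ℕG
import Data.Nat.Divisibility as ℕD
open import Data.Integer as ℤ
  using (ℤ; +_; -[1+_]; +0; +[1+_]; _+_; _-_; _*_; -_; ∣_∣; _≤_; _<_; _≤ᵇ_; _⊓_; _⊔_; 0ℤ; 1ℤ; _/ℕ_; _%ℕ_; +≤+; +<+; -<+)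
import Data.Integer.Properties as ℤP
import Data.Integer.DivMod as ℤDM
open import Data.Integer.Tactic.RingSolver using (solve; solve-∀)
open import Data.Bool using (Bool; true; false; T; _∧_; _∨_)
open import Data.Bool.Properties using (T-∧; T-∨)
open import Data.Product using (_×_; _,_; proj₁; proj₂)
open import Data.Sum using (_⊎_; inj₁; inj₂; [_,_]′)
open import Data.Unit using (tt)
open import Data.Maybe using (just)
open import Data.List using (List; []; _∷_; _++_; map; length; reverse; filterᵇ)
import Data.List.Properties as ListP
open import Data.List.Relation.Unary.All as All using (All)
import Data.List.Relation.Unary.All.Properties as AllP
import Data.List.Relation.Unary.AllPairs as AllPairs
import Data.List.Relation.Unary.AllPairs.Properties as AllPairsP
import Data.List.Relation.Unary.Any as Any
open import Data.List.Relation.Unary.Any using (here; there)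
open import Data.List.Relation.Unary.Unique.Propositional using (Unique)
import Data.List.Relation.Unary.Unique.Propositional.Properties as UniqueP
open import Data.List.Membership.Propositional using (_∈_)
import Data.List.Membership.Propositional.Properties as ∈P
open import Data.List.Membership.Propositional.Properties.WithK using (unique∧set⇒bag)
open import Data.List.Relation.Binary.BagAndSetEquality using (∼bag⇒↭)
open import Data.List.Relation.Binary.Permutation.Propositional.Properties using (↭-length)
open import Function using (_∋_)
open import Function.Bundles using (Equivalence; mk⇔)
open import Relation.Nullary using (¬_; yes; no; contradiction)
open import Relation.Nullary.Decidable using (T?)
open import Relation.Binary.PropositionalEquality

-- Integer arithmetic

≤-by : ∀ {a b} d → b - a ≡ d → 0ℤ ≤ d → a ≤ b
≤-by d eq 0≤d = ℤP.0≤i-j⇒j≤i (subst (0ℤ ≤_) (sym eq) 0≤d)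

<-by : ∀ {a b} d → b - a - 1ℤ ≡ d → 0ℤ ≤ d → a < b
<-by {a} {b} d eq 0≤d =
  ℤP.suc[i]≤j⇒i<j (≤-by d (trans (b - (1ℤ + a) ≡ b - a - 1ℤ ∋ solve (a ∷ b ∷ [])) eq) 0≤d)

0≤+ : ∀ {a b} → 0ℤ ≤ a → 0ℤ ≤ b → 0ℤ ≤ a + b
0≤+ = ℤP.+-mono-≤

0≤* : ∀ {a b} → 0ℤ ≤ a → 0ℤ ≤ b → 0ℤ ≤ a * b
0≤* {+ m} {+ n} _ _ = subst (0ℤ ≤_) (ℤP.pos-* m n) (+≤+ ℕ.z≤n)

0≤+n : ∀ n → 0ℤ ≤ + n
0≤+n n = +≤+ ℕ.z≤n

0≤-diff : ∀ {a b} → a ≤ b → 0ℤ ≤ b - a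
0≤-diff = ℤP.i≤j⇒0≤j-i

0≤-diff-1 : ∀ {a b} → a < b → 0ℤ ≤ b - a - 1ℤ
0≤-diff-1 {a} {b} a<b =
  subst (0ℤ ≤_) (b - (1ℤ + a) ≡ b - a - 1ℤ ∋ solve (a ∷ b ∷ [])) (0≤-diff (ℤP.i<j⇒suc[i]≤j a<b))

0<-diff⇒< : ∀ {a b} → 0ℤ < b - a → a < b
0<-diff⇒< {a} {b} 0<b-a =
  <-by (b - a - 1ℤ) refl (subst (0ℤ ≤_) (b - a - 0ℤ - 1ℤ ≡ b - a - 1ℤ ∋ solve (a ∷ b ∷ [])) (0≤-diff-1 0<b-a))

0<-diff⇒≤ : ∀ {a b} → 0ℤ < b - a + 1ℤ → a ≤ b
0<-diff⇒≤ {a} {b} 0<b-a+1 =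
  ≤-by (b - a) refl (subst (0ℤ ≤_) (b - a + 1ℤ - 0ℤ - 1ℤ ≡ b - a ∋ solve (a ∷ b ∷ [])) (0≤-diff-1 0<b-a+1))

1≤⇒0< : ∀ {a} → 1ℤ ≤ a → 0ℤ < a
1≤⇒0< = ℤP.<-≤-trans (+<+ (ℕ.s≤s ℕ.z≤n))

1≤⇒0≤ : ∀ {a} → 1ℤ ≤ a → 0ℤ ≤ a
1≤⇒0≤ 1≤a = ℤP.<⇒≤ (1≤⇒0< 1≤a)

0<-+ : ∀ {a b} → 0ℤ < a → 0ℤ ≤ b → 0ℤ < a + b
0<-+ = ℤP.+-mono-<-≤

0<* : ∀ {a b} → 0ℤ < a → 0ℤ < b → 0ℤ < a * b
0<* {a} {b} 0<a 0<b = subst (_< a * b) (ℤP.*-zeroʳ a) (ℤP.*-monoˡ-<-pos a {{ℤ.positive 0<a}} 0<b)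

0<-cancel : ∀ {k x} → 0ℤ < k → 0ℤ < k * x → 0ℤ < x
0<-cancel {k} {x} 0<k 0<kx =
  ℤP.*-cancelˡ-<-nonNeg k {{ℤ.nonNegative (ℤP.<⇒≤ 0<k)}} (subst (_< k * x) (sym (ℤP.*-zeroʳ k)) 0<kx)

0≤-cancel : ∀ {k x} → 0ℤ < k → 0ℤ ≤ k * x → 0ℤ ≤ x
0≤-cancel {k} {x} 0<k 0≤kx =
  ℤP.*-cancelˡ-≤-pos 0ℤ x k {{ℤ.positive 0<k}} (subst (_≤ k * x) (sym (ℤP.*-zeroʳ k)) 0≤kx)

*-cancel-pos : ∀ {k} x y → 0ℤ < k → k * x ≡ k * y → x ≡ y
*-cancel-pos {+[1+ n ]} x y _ eq = ℤP.*-cancelˡ-≡ +[1+ n ] x y eq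
*-cancel-pos {+0} x y (+<+ ()) eq

sgn*self : ∀ x → sgnℤ x * x ≡ + ∣ x ∣
sgn*self +0 = refl
sgn*self +[1+ n ] = ℤP.*-identityˡ _
sgn*self -[1+ n ] = ℤP.-1*i≡-i -[1+ n ]

sgn*abs : ∀ x → sgnℤ x * + ∣ x ∣ ≡ x
sgn*abs +0 = refl
sgn*abs +[1+ n ] = ℤP.*-identityˡ _
sgn*abs -[1+ n ] = ℤP.-1*i≡-i +[1+ n ]

sgn-pos : ∀ {x} → 0ℤ < x → sgnℤ x ≡ 1ℤ
sgn-pos (+<+ {n = suc n} _) = refl

sgn*sgn : ∀ {x} → x ≢ 0ℤ → sgnℤ x * sgnℤ x ≡ 1ℤ
sgn*sgn {+0} x≢0 = contradiction refl x≢0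
sgn*sgn {+[1+ n ]} _ = refl
sgn*sgn { -[1+ n ]} _ = refl

0<sgn*self : ∀ {x} → x ≢ 0ℤ → 0ℤ < sgnℤ x * x
0<sgn*self {x} x≢0 =
  subst (0ℤ <_) (sym (sgn*self x)) (+<+ (ℕP.n≢0⇒n>0 (λ ∣x∣≡0 → x≢0 (ℤP.∣i∣≡0⇒i≡0 ∣x∣≡0))))

sgn-neg : ∀ {x} → x < 0ℤ → sgnℤ x ≡ - 1ℤ
sgn-neg { -[1+ n ]} _ = refl
sgn-neg {+ n} (+<+ ())

sgn-*-pos : ∀ {k} x → 0ℤ < k → sgnℤ (k * x) ≡ sgnℤ x
sgn-*-pos {k} +0 _ = cong sgnℤ (ℤP.*-zeroʳ k)
sgn-*-pos +[1+ n ] 0<k = sgn-pos (0<* 0<k (+<+ (ℕ.s≤s ℕ.z≤n)))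
sgn-*-pos {k} -[1+ n ] 0<k =
  sgn-neg (subst (k * -[1+ n ] <_) (ℤP.*-zeroʳ k) (ℤP.*-monoˡ-<-pos k {{ℤ.positive 0<k}} -<+))

unit-cases : ∀ σ → σ * σ ≡ 1ℤ → σ ≡ 1ℤ ⊎ σ ≡ - 1ℤ
unit-cases +[1+ zero ] _ = inj₁ refl
unit-cases -[1+ zero ] _ = inj₂ refl
unit-cases +0 ()
unit-cases +[1+ suc n ] ()
unit-cases -[1+ suc n ] ()

sgn≡⇒0<sgn* : ∀ {x y} → sgnℤ x ≡ sgnℤ y → y ≢ 0ℤ → 0ℤ < sgnℤ x * y
sgn≡⇒0<sgn* {x} sx≡sy y≢0 = subst (λ s → 0ℤ < s * _) (sym sx≡sy) (0<sgn*self y≢0)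

∣∣≡1⇒±unit : ∀ x {y} → ∣ x ∣ ≡ 1 → y * y ≡ 1ℤ → x ≡ - y ⊎ x ≡ y
∣∣≡1⇒±unit x {y} ∣x∣≡1 yy≡1 with unit-cases y yy≡1
∣∣≡1⇒±unit +[1+ zero ] _ _ | inj₁ refl = inj₂ refl
∣∣≡1⇒±unit -[1+ zero ] _ _ | inj₁ refl = inj₁ refl
∣∣≡1⇒±unit +[1+ zero ] _ _ | inj₂ refl = inj₁ refl
∣∣≡1⇒±unit -[1+ zero ] _ _ | inj₂ refl = inj₂ refl
∣∣≡1⇒±unit +0 () _ | _
∣∣≡1⇒±unit +[1+ suc n ] () _ | _
∣∣≡1⇒±unit -[1+ suc n ] () _ | _

-- Plane vectors and determinants

e₁ e₂ : Point
e₁ = (1ℤ , 0ℤ)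
e₂ = (0ℤ , 1ℤ)

neg : Point → Point
neg v = (- 1ℤ) · v

lin : Point → Point → Point → Point
lin v w (x , y) = (x · v) ⊕ (y · w)

lin-* : ∀ v w x y k → lin v w (x * k , y * k) ≡ k · lin v w (x , y)
lin-* (v , v′) (w , w′) x y k = cong₂ _,_ (x * k * v + y * k * w ≡ k * (x * v + y * w) ∋ solve (x ∷ y ∷ k ∷ v ∷ w ∷ []))
                                          (x * k * v′ + y * k * w′ ≡ k * (x * v′ + y * w′) ∋ solve (x ∷ y ∷ k ∷ v′ ∷ w′ ∷ []))

neg-neg : ∀ v → neg (neg v) ≡ v
neg-neg (a , b) = cong₂ _,_ (- 1ℤ * (- 1ℤ * a) ≡ a ∋ solve (a ∷ [])) (- 1ℤ * (- 1ℤ * b) ≡ b ∋ solve (b ∷ []))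

neg-⊖ : ∀ A B → A ⊖ B ≡ neg (B ⊖ A)
neg-⊖ (a , a′) (b , b′) =
  cong₂ _,_ (a - b ≡ - 1ℤ * (b - a) ∋ solve (a ∷ b ∷ [])) (a′ - b′ ≡ - 1ℤ * (b′ - a′) ∋ solve (a′ ∷ b′ ∷ []))

·-neg : ∀ k v → k · neg v ≡ neg (k · v)
·-neg k (a , b) =
  cong₂ _,_ (k * (- 1ℤ * a) ≡ - 1ℤ * (k * a) ∋ solve (k ∷ a ∷ [])) (k * (- 1ℤ * b) ≡ - 1ℤ * (k * b) ∋ solve (k ∷ b ∷ []))

1· : ∀ v → 1ℤ · v ≡ v
1· (a , b) = cong₂ _,_ (ℤP.*-identityˡ a) (ℤP.*-identityˡ b)

⊖-O : ∀ P → P ⊖ O ≡ P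
⊖-O (x , y) = cong₂ _,_ (ℤP.+-identityʳ x) (ℤP.+-identityʳ y)

O-⊖ : ∀ P → O ⊖ P ≡ neg P
O-⊖ (x , y) = cong₂ _,_ (0ℤ - x ≡ - 1ℤ * x ∋ solve (x ∷ [])) (0ℤ - y ≡ - 1ℤ * y ∋ solve (y ∷ []))

⊕-⊖ : ∀ Y v → (Y ⊕ v) ⊖ Y ≡ v
⊕-⊖ (y , y′) (v , v′) = cong₂ _,_ (y + v - y ≡ v ∋ solve (y ∷ v ∷ [])) (y′ + v′ - y′ ≡ v′ ∋ solve (y′ ∷ v′ ∷ []))

⊖-⊕ : ∀ Y P → Y ⊕ (P ⊖ Y) ≡ P
⊖-⊕ (y , y′) (p , p′) = cong₂ _,_ (y + (p - y) ≡ p ∋ solve (y ∷ p ∷ [])) (y′ + (p′ - y′) ≡ p′ ∋ solve (y′ ∷ p′ ∷ []))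

⊖-⊖ : ∀ X Y Z → X ⊖ Z ≡ (X ⊖ Y) ⊖ (Z ⊖ Y)
⊖-⊖ (x , x′) (y , y′) (z , z′) =
  cong₂ _,_ (x - z ≡ (x - y) - (z - y) ∋ solve (x ∷ y ∷ z ∷ [])) (x′ - z′ ≡ (x′ - y′) - (z′ - y′) ∋ solve (x′ ∷ y′ ∷ z′ ∷ []))

lin-e₁ : ∀ v w → lin v w e₁ ≡ v
lin-e₁ (v , v′) (w , w′) = cong₂ _,_ (1ℤ * v + 0ℤ * w ≡ v ∋ solve (v ∷ w ∷ [])) (1ℤ * v′ + 0ℤ * w′ ≡ v′ ∋ solve (v′ ∷ w′ ∷ []))

lin-e₂ : ∀ v w → lin v w e₂ ≡ w
lin-e₂ (v , v′) (w , w′) = cong₂ _,_ (0ℤ * v + 1ℤ * w ≡ w ∋ solve (v ∷ w ∷ [])) (0ℤ * v′ + 1ℤ * w′ ≡ w′ ∋ solve (v′ ∷ w′ ∷ []))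

lin-neg-e₁ : ∀ v w → lin v w (neg e₁) ≡ neg v
lin-neg-e₁ (v , v′) (w , w′) =
  cong₂ _,_ (- 1ℤ * v + 0ℤ * w ≡ - 1ℤ * v ∋ solve (v ∷ w ∷ [])) (- 1ℤ * v′ + 0ℤ * w′ ≡ - 1ℤ * v′ ∋ solve (v′ ∷ w′ ∷ []))

det-self : ∀ v → det v v ≡ 0ℤ
det-self (a , b) = a * b - b * a ≡ 0ℤ ∋ solve (a ∷ b ∷ [])

det-e₁ : ∀ X → det e₁ X ≡ proj₂ X
det-e₁ (x , y) = 1ℤ * y - 0ℤ * x ≡ y ∋ solve (x ∷ y ∷ [])

det-O : ∀ v → det v O ≡ 0ℤ
det-O (a , b) = a * 0ℤ - b * 0ℤ ≡ 0ℤ ∋ solve (a ∷ b ∷ [])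

det-antisym : ∀ u v → det u v ≡ - det v u
det-antisym (a , b) (c , d) = a * d - b * c ≡ - (c * b - d * a) ∋ solve (a ∷ b ∷ c ∷ d ∷ [])

det-·ˡ : ∀ k u v → det (k · u) v ≡ k * det u v
det-·ˡ k (a , b) (c , d) = (k * a) * d - (k * b) * c ≡ k * (a * d - b * c) ∋ solve (k ∷ a ∷ b ∷ c ∷ d ∷ [])

det-·ʳ : ∀ k u v → det u (k · v) ≡ k * det u v
det-·ʳ k (a , b) (c , d) = a * (k * d) - b * (k * c) ≡ k * (a * d - b * c) ∋ solve (k ∷ a ∷ b ∷ c ∷ d ∷ [])

det-negˡ : ∀ u v → det (neg u) v ≡ - det u v
det-negˡ u v = trans (det-·ˡ (- 1ℤ) u v) (ℤP.-1*i≡-i _)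

det-negʳ : ∀ u v → det u (neg v) ≡ - det u v
det-negʳ u v = trans (det-·ʳ (- 1ℤ) u v) (ℤP.-1*i≡-i _)

det-⊖ˡ : ∀ x y z → det (x ⊖ y) z ≡ det x z - det y z
det-⊖ˡ (a , b) (c , d) (e , f) =
  (a - c) * f - (b - d) * e ≡ (a * f - b * e) - (c * f - d * e) ∋ solve (a ∷ b ∷ c ∷ d ∷ e ∷ f ∷ [])

det-⊖ʳ : ∀ x y z → det z (x ⊖ y) ≡ det z x - det z y
det-⊖ʳ (a , b) (c , d) (e , f) =
  e * (b - d) - f * (a - c) ≡ (e * b - f * a) - (e * d - f * c) ∋ solve (a ∷ b ∷ c ∷ d ∷ e ∷ f ∷ [])

det-linˡ : ∀ v w x y z → det (lin v w (x , y)) z ≡ x * det v z + y * det w z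
det-linˡ (v , v′) (w , w′) x y (z , z′) =
  (x * v + y * w) * z′ - (x * v′ + y * w′) * z ≡ x * (v * z′ - v′ * z) + y * (w * z′ - w′ * z)
    ∋ solve (v ∷ v′ ∷ w ∷ w′ ∷ x ∷ y ∷ z ∷ z′ ∷ [])

det-linʳ : ∀ v w x y z → det z (lin v w (x , y)) ≡ x * det z v + y * det z w
det-linʳ (v , v′) (w , w′) x y (z , z′) =
  z * (x * v′ + y * w′) - z′ * (x * v + y * w) ≡ x * (z * v′ - z′ * v) + y * (z * w′ - z′ * w)
    ∋ solve (v ∷ v′ ∷ w ∷ w′ ∷ x ∷ y ∷ z ∷ z′ ∷ [])

det-lin : ∀ v w X Y → det (lin v w X) (lin v w Y) ≡ det X Y * det v w
det-lin (v , v′) (w , w′) (x , x′) (y , y′) =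
  (x * v + x′ * w) * (y * v′ + y′ * w′) - (x * v′ + x′ * w′) * (y * v + y′ * w) ≡ (x * y′ - x′ * y) * (v * w′ - v′ * w)
    ∋ solve (v ∷ v′ ∷ w ∷ w′ ∷ x ∷ x′ ∷ y ∷ y′ ∷ [])

det-cycle : ∀ X Y Z → det (X ⊖ Y) (Z ⊖ Y) ≡ det (Y ⊖ Z) (X ⊖ Z)
det-cycle (x , x′) (y , y′) (z , z′) =
  (x - y) * (z′ - y′) - (x′ - y′) * (z - y) ≡ (y - z) * (x′ - z′) - (y′ - z′) * (x - z)
    ∋ solve (x ∷ x′ ∷ y ∷ y′ ∷ z ∷ z′ ∷ [])

det-shiftˡ : ∀ X Y Z → det (X ⊖ Z) (Z ⊖ Y) ≡ det (X ⊖ Y) (Z ⊖ Y)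
det-shiftˡ (x , x′) (y , y′) (z , z′) =
  (x - z) * (z′ - y′) - (x′ - z′) * (z - y) ≡ (x - y) * (z′ - y′) - (x′ - y′) * (z - y)
    ∋ solve (x ∷ x′ ∷ y ∷ y′ ∷ z ∷ z′ ∷ [])

det-shiftʳ : ∀ X Y Z → det (X ⊖ Y) (Z ⊖ X) ≡ det (X ⊖ Y) (Z ⊖ Y)
det-shiftʳ (x , x′) (y , y′) (z , z′) =
  (x - y) * (z′ - x′) - (x′ - y′) * (z - x) ≡ (x - y) * (z′ - y′) - (x′ - y′) * (z - y)
    ∋ solve (x ∷ x′ ∷ y ∷ y′ ∷ z ∷ z′ ∷ [])

cramer : ∀ u e v → det u e ≡ 1ℤ → v ≡ (det v e · u) ⊕ (det u v · e)
cramer (u , u′) (e , e′) (x , x′) ue≡1 = cong₂ _,_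
  (trans (times-unimodular x) (x * (u * e′ - u′ * e) ≡ (x * e′ - x′ * e) * u + (u * x′ - u′ * x) * e
                                 ∋ solve (x ∷ x′ ∷ u ∷ u′ ∷ e ∷ e′ ∷ [])))
  (trans (times-unimodular x′) (x′ * (u * e′ - u′ * e) ≡ (x * e′ - x′ * e) * u′ + (u * x′ - u′ * x) * e′
                                  ∋ solve (x ∷ x′ ∷ u ∷ u′ ∷ e ∷ e′ ∷ [])))
  where
  times-unimodular : ∀ t → t ≡ t * (u * e′ - u′ * e)
  times-unimodular t = trans (sym (ℤP.*-identityʳ t)) (cong (t *_) (sym ue≡1))

plücker : ∀ u e x y → det u e ≡ 1ℤ → det x y ≡ det x e * det u y - det u x * det y e
plücker (u , u′) (e , e′) (x , x′) (y , y′) ue≡1 =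
  trans (trans (sym (ℤP.*-identityʳ _)) (cong ((x * y′ - x′ * y) *_) (sym ue≡1)))
    ((x * y′ - x′ * y) * (u * e′ - u′ * e) ≡ (x * e′ - x′ * e) * (u * y′ - u′ * y) - (u * x′ - u′ * x) * (y * e′ - y′ * e)
      ∋ solve (u ∷ u′ ∷ e ∷ e′ ∷ x ∷ x′ ∷ y ∷ y′ ∷ []))

*-cancel-unit : ∀ {δ} s t → δ * δ ≡ 1ℤ → s * δ ≡ t * δ → s ≡ t
*-cancel-unit {δ} s t δδ≡1 eq = begin
  s           ≡⟨ sym (ℤP.*-identityʳ s) ⟩
  s * 1ℤ      ≡⟨ cong (s *_) (sym δδ≡1) ⟩
  s * (δ * δ) ≡⟨ sym (ℤP.*-assoc s δ δ) ⟩
  s * δ * δ   ≡⟨ cong (_* δ) eq ⟩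
  t * δ * δ   ≡⟨ ℤP.*-assoc t δ δ ⟩
  t * (δ * δ) ≡⟨ cong (t *_) δδ≡1 ⟩
  t * 1ℤ      ≡⟨ ℤP.*-identityʳ t ⟩
  t           ∎
  where open ≡-Reasoning

det-lin-coord₁ : ∀ v w x y → det (lin v w (x , y)) w ≡ x * det v w
det-lin-coord₁ v w x y = trans (det-linˡ v w x y w) (trans (cong (λ t → x * det v w + y * t) (det-self w)) (drop (det v w)))
  where
  drop : ∀ δ → x * δ + y * 0ℤ ≡ x * δ
  drop δ = solve (x ∷ y ∷ δ ∷ [])

det-lin-coord₂ : ∀ v w x y → det v (lin v w (x , y)) ≡ y * det v w
det-lin-coord₂ v w x y = trans (det-linʳ v w x y v) (trans (cong (λ t → x * t + y * det v w) (det-self v)) (drop (det v w)))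
  where
  drop : ∀ δ → x * 0ℤ + y * δ ≡ y * δ
  drop δ = solve (x ∷ y ∷ δ ∷ [])

lin-injective : ∀ v w {X X′} → det v w * det v w ≡ 1ℤ → lin v w X ≡ lin v w X′ → X ≡ X′
lin-injective v w {x , y} {x′ , y′} δδ≡1 eq = cong₂ _,_
  (*-cancel-unit x x′ δδ≡1 (trans (sym (det-lin-coord₁ v w x y)) (trans (cong (λ z → det z w) eq) (det-lin-coord₁ v w x′ y′))))
  (*-cancel-unit y y′ δδ≡1 (trans (sym (det-lin-coord₂ v w x y)) (trans (cong (det v) eq) (det-lin-coord₂ v w x′ y′))))

-- Primitive vectors

%ℕ≡0 : ∀ a d .{{_ : ℕ.NonZero d}} → d ℕD.∣ ∣ a ∣ → a %ℕ d ≡ 0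
%ℕ≡0 (+ n) d d∣a = ℕD.n∣m⇒m%n≡0 n d d∣a
%ℕ≡0 -[1+ n ] d d∣a with suc n ℕ.% d | ℕD.n∣m⇒m%n≡0 (suc n) d d∣a
... | zero | _ = refl

*-/ℕ : ∀ a d .{{_ : ℕ.NonZero d}} → d ℕD.∣ ∣ a ∣ → + d * (a /ℕ d) ≡ a
*-/ℕ a d d∣a = begin
  + d * (a /ℕ d)              ≡⟨ ℤP.*-comm (+ d) _ ⟩
  (a /ℕ d) * + d              ≡⟨ sym (ℤP.+-identityˡ _) ⟩
  + 0 + (a /ℕ d) * + d        ≡⟨ cong (λ r → + r + (a /ℕ d) * + d) (sym (%ℕ≡0 a d d∣a)) ⟩
  + (a %ℕ d) + (a /ℕ d) * + d ≡⟨ sym (ℤDM.a≡a%ℕn+[a/ℕn]*n a d) ⟩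
  a                           ∎
  where open ≡-Reasoning

gcdv·prim : ∀ v → (+ gcdv v) · prim v ≡ v
gcdv·prim (a , b) with ℕG.gcd ∣ a ∣ ∣ b ∣ in g≡
... | zero = cong₂ _,_ (sym (ℤP.∣i∣≡0⇒i≡0 (ℕG.gcd[m,n]≡0⇒m≡0 g≡)))
                       (sym (ℤP.∣i∣≡0⇒i≡0 (ℕG.gcd[m,n]≡0⇒n≡0 ∣ a ∣ g≡)))
... | suc k = cong₂ _,_ (*-/ℕ a (suc k) (subst (ℕD._∣ ∣ a ∣) g≡ (ℕG.gcd[m,n]∣m ∣ a ∣ ∣ b ∣)))
                        (*-/ℕ b (suc k) (subst (ℕD._∣ ∣ b ∣) g≡ (ℕG.gcd[m,n]∣n ∣ a ∣ ∣ b ∣)))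

gcdv-· : ∀ k v → gcdv (k · v) ≡ ∣ k ∣ ℕ.* gcdv v
gcdv-· k (a , b) = begin
  ℕG.gcd (∣ k * a ∣) (∣ k * b ∣)         ≡⟨ cong₂ ℕG.gcd (ℤP.abs-* k a) (ℤP.abs-* k b) ⟩
  ℕG.gcd (∣ k ∣ ℕ.* ∣ a ∣) (∣ k ∣ ℕ.* ∣ b ∣) ≡⟨ sym (ℕG.c*gcd[m,n]≡gcd[cm,cn] (∣ k ∣) (∣ a ∣) (∣ b ∣)) ⟩
  ∣ k ∣ ℕ.* ℕG.gcd (∣ a ∣) (∣ b ∣)       ∎
  where open ≡-Reasoning

gcdv-neg : ∀ v → gcdv (neg v) ≡ gcdv v
gcdv-neg v = trans (gcdv-· (- 1ℤ) v) (ℕP.*-identityˡ _)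

gcdv≢0 : ∀ v → v ≢ O → gcdv v ≢ 0
gcdv≢0 (a , b) v≢O g≡0 =
  v≢O (cong₂ _,_ (ℤP.∣i∣≡0⇒i≡0 (ℕG.gcd[m,n]≡0⇒m≡0 g≡0)) (ℤP.∣i∣≡0⇒i≡0 (ℕG.gcd[m,n]≡0⇒n≡0 ∣ a ∣ g≡0)))

0<gcdv : ∀ v → v ≢ O → 0ℤ < + gcdv v
0<gcdv v v≢O = +<+ (ℕP.n≢0⇒n>0 (gcdv≢0 v v≢O))

gcdv-prim : ∀ v → v ≢ O → gcdv (prim v) ≡ 1
gcdv-prim v v≢O = ℕP.*-cancelˡ-≡ (gcdv (prim v)) 1 (gcdv v) {{ℕ.≢-nonZero (gcdv≢0 v v≢O)}} (begin
  gcdv v ℕ.* gcdv (prim v)   ≡⟨ sym (gcdv-· (+ gcdv v) (prim v)) ⟩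
  gcdv ((+ gcdv v) · prim v) ≡⟨ cong gcdv (gcdv·prim v) ⟩
  gcdv v                     ≡⟨ sym (ℕP.*-identityʳ _) ⟩
  gcdv v ℕ.* 1               ∎)
  where open ≡-Reasoning

·-cancel-pos : ∀ {k} x y → 0ℤ < k → k · x ≡ k · y → x ≡ y
·-cancel-pos (a , b) (c , d) 0<k eq =
  cong₂ _,_ (*-cancel-pos a c 0<k (cong proj₁ eq)) (*-cancel-pos b d 0<k (cong proj₂ eq))

prim-neg : ∀ v → v ≢ O → prim (neg v) ≡ neg (prim v)
prim-neg v v≢O = ·-cancel-pos _ _ (0<gcdv v v≢O) (begin
  (+ gcdv v) · prim (neg v)       ≡⟨ cong (λ g → (+ g) · prim (neg v)) (sym (gcdv-neg v)) ⟩
  (+ gcdv (neg v)) · prim (neg v) ≡⟨ gcdv·prim (neg v) ⟩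
  neg v                           ≡⟨ cong neg (sym (gcdv·prim v)) ⟩
  neg ((+ gcdv v) · prim v)       ≡⟨ sym (·-neg (+ gcdv v) (prim v)) ⟩
  (+ gcdv v) · neg (prim v)       ∎)
  where open ≡-Reasoning

det-primˡ : ∀ x y → + gcdv x * det (prim x) y ≡ det x y
det-primˡ x y = trans (sym (det-·ˡ (+ gcdv x) (prim x) y)) (cong (λ z → det z y) (gcdv·prim x))

det-primʳ : ∀ x y → + gcdv y * det x (prim y) ≡ det x y
det-primʳ x y = trans (sym (det-·ʳ (+ gcdv y) x (prim y))) (cong (det x) (gcdv·prim y))

det-prim-prim : ∀ x y → (+ gcdv x * + gcdv y) * det (prim x) (prim y) ≡ det x y
det-prim-prim x y = begin
  (+ gcdv x * + gcdv y) * det (prim x) (prim y) ≡⟨ ℤP.*-assoc (+ gcdv x) _ _ ⟩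
  + gcdv x * (+ gcdv y * det (prim x) (prim y)) ≡⟨ cong (+ gcdv x *_) (det-primʳ (prim x) y) ⟩
  + gcdv x * det (prim x) y                     ≡⟨ det-primˡ x y ⟩
  det x y                                       ∎
  where open ≡-Reasoning

sgn-det-prim : ∀ x y → x ≢ O → y ≢ O → sgnℤ (det (prim x) (prim y)) ≡ sgnℤ (det x y)
sgn-det-prim x y x≢O y≢O =
  trans (sym (sgn-*-pos (det (prim x) (prim y)) (0<* (0<gcdv x x≢O) (0<gcdv y y≢O)))) (cong sgnℤ (det-prim-prim x y))

det-prim-prim≢0 : ∀ x y → det x y ≢ 0ℤ → det (prim x) (prim y) ≢ 0ℤ
det-prim-prim≢0 x y xy≢0 eq =
  xy≢0 (trans (sym (det-prim-prim x y)) (trans (cong ((+ gcdv x * + gcdv y) *_) eq) (ℤP.*-zeroʳ (+ gcdv x * + gcdv y))))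

gcdv-unimodular : ∀ P f → det P f ≡ 1ℤ → gcdv f ≡ 1
gcdv-unimodular P f Pf≡1 = ℕP.m*n≡1⇒m≡1 (gcdv f) ∣ det P (prim f) ∣
  (trans (sym (ℤP.abs-* (+ gcdv f) (det P (prim f)))) (cong ∣_∣ (trans (det-primʳ P f) Pf≡1)))

-- Broken lines generated by a sequence

innerVertices : Point → Point → List ℤ → List Point
innerVertices P f (a ∷ b ∷ s) = (P ⊕ (a · f)) ∷ innerVertices (P ⊕ (a · f)) (f ⊕ (b · (P ⊕ (a · f)))) s
innerVertices P f _ = []

endPoint : Point → Point → List ℤ → Point
endPoint P f [] = P
endPoint P f (a ∷ []) = P ⊕ (a · f)
endPoint P f (a ∷ b ∷ s) = endPoint (P ⊕ (a · f)) (f ⊕ (b · (P ⊕ (a · f)))) s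

endDirection : Point → Point → List ℤ → Point
endDirection P f (a ∷ b ∷ s) = endDirection (P ⊕ (a · f)) (f ⊕ (b · (P ⊕ (a · f)))) s
endDirection P f _ = f

lineFrom : Point → Point → List ℤ → List Point
lineFrom P f s = P ∷ (innerVertices P f s ++ endPoint P f s ∷ [])

infixr 5 _∷⁺_

data EdgesPositive : List ℤ → Set where
  [_] : ∀ {a} → 0ℤ < a → EdgesPositive (a ∷ [])
  _∷⁺_ : ∀ {a b s} → 0ℤ < a → EdgesPositive s → EdgesPositive (a ∷ b ∷ s)

EdgesPositive-++ : ∀ c m s → EdgesPositive c → EdgesPositive s → EdgesPositive (c ++ m ∷ s)
EdgesPositive-++ (a ∷ []) m s [ 0<a ] Es = 0<a ∷⁺ Es
EdgesPositive-++ (a ∷ b ∷ c) m s (0<a ∷⁺ Ec) Es = 0<a ∷⁺ EdgesPositive-++ c m s Ec Es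

IsLinear : (Point → Point) → Set
IsLinear L = ∀ P f a → L (P ⊕ (a · f)) ≡ L P ⊕ (a · L f)

lin-isLinear : ∀ v w → IsLinear (lin v w)
lin-isLinear (v , v′) (w , w′) (x , y) (f , f′) a = cong₂ _,_ (distrib v w) (distrib v′ w′)
  where
  distrib : ∀ v w → (x + a * f) * v + (y + a * f′) * w ≡ (x * v + y * w) + a * (f * v + f′ * w)
  distrib v w = solve (x ∷ y ∷ f ∷ f′ ∷ a ∷ v ∷ w ∷ [])

neg-isLinear : IsLinear neg
neg-isLinear (x , y) (f , f′) a = cong₂ _,_ (distrib x f) (distrib y f′)
  where
  distrib : ∀ x f → - 1ℤ * (x + a * f) ≡ - 1ℤ * x + a * (- 1ℤ * f)
  distrib x f = solve (x ∷ f ∷ a ∷ [])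

module _ (L : Point → Point) (linear : IsLinear L) where

  private
    step : ∀ P f a b → L P ⊕ (a · L f) ≡ L (P ⊕ (a · f))
                     × L f ⊕ (b · (L P ⊕ (a · L f))) ≡ L (f ⊕ (b · (P ⊕ (a · f))))
    step P f a b = sym (linear P f a)
                 , trans (cong (λ Q → L f ⊕ (b · Q)) (sym (linear P f a))) (sym (linear f (P ⊕ (a · f)) b))

  innerVertices-linear : ∀ P f s → innerVertices (L P) (L f) s ≡ map L (innerVertices P f s)
  innerVertices-linear P f (a ∷ b ∷ s) with step P f a b
  ... | P≡ , f≡ = cong₂ _∷_ P≡ (trans (cong₂ (λ Q g → innerVertices Q g s) P≡ f≡) (innerVertices-linear _ _ s))
  innerVertices-linear P f [] = refl
  innerVertices-linear P f (a ∷ []) = refl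

  endPoint-linear : ∀ P f s → endPoint (L P) (L f) s ≡ L (endPoint P f s)
  endPoint-linear P f [] = refl
  endPoint-linear P f (a ∷ []) = sym (linear P f a)
  endPoint-linear P f (a ∷ b ∷ s) with step P f a b
  ... | P≡ , f≡ = trans (cong₂ (λ Q g → endPoint Q g s) P≡ f≡) (endPoint-linear _ _ s)

  endDirection-linear : ∀ P f s → endDirection (L P) (L f) s ≡ L (endDirection P f s)
  endDirection-linear P f (a ∷ b ∷ s) with step P f a b
  ... | P≡ , f≡ = trans (cong₂ (λ Q g → endDirection Q g s) P≡ f≡) (endDirection-linear _ _ s)
  endDirection-linear P f [] = refl
  endDirection-linear P f (a ∷ []) = refl

module _ (v w : Point) (s : List ℤ) where

  private
    fromBasis : ∀ {A : Set} (F : Point → Point → List ℤ → A) → F v w s ≡ F (lin v w e₁) (lin v w e₂) s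
    fromBasis F = sym (cong₂ (λ P f → F P f s) (lin-e₁ v w) (lin-e₂ v w))

  innerVertices-lin : innerVertices v w s ≡ map (lin v w) (innerVertices e₁ e₂ s)
  innerVertices-lin = trans (fromBasis innerVertices) (innerVertices-linear (lin v w) (lin-isLinear v w) e₁ e₂ s)

  endPoint-lin : endPoint v w s ≡ lin v w (endPoint e₁ e₂ s)
  endPoint-lin = trans (fromBasis endPoint) (endPoint-linear (lin v w) (lin-isLinear v w) e₁ e₂ s)

  endDirection-lin : endDirection v w s ≡ lin v w (endDirection e₁ e₂ s)
  endDirection-lin = trans (fromBasis endDirection) (endDirection-linear (lin v w) (lin-isLinear v w) e₁ e₂ s)

innerVertices-++ : ∀ P f c m s → EdgesPositive c →
  innerVertices P f (c ++ m ∷ s) ≡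
  innerVertices P f c ++ endPoint P f c ∷ innerVertices (endPoint P f c) (endDirection P f c ⊕ (m · endPoint P f c)) s
innerVertices-++ P f (a ∷ []) m s [ _ ] = refl
innerVertices-++ P f (a ∷ b ∷ c) m s (_ ∷⁺ Ec) = cong (_ ∷_) (innerVertices-++ _ _ c m s Ec)

endPoint-++ : ∀ P f c m s → EdgesPositive c →
  endPoint P f (c ++ m ∷ s) ≡ endPoint (endPoint P f c) (endDirection P f c ⊕ (m · endPoint P f c)) s
endPoint-++ P f (a ∷ []) m s [ _ ] = refl
endPoint-++ P f (a ∷ b ∷ c) m s (_ ∷⁺ Ec) = endPoint-++ _ _ c m s Ec

lineFrom-join : ∀ P f c m rest P′ f′ → EdgesPositive c →
  endPoint P f c ≡ P′ → endDirection P f c ⊕ (m · P′) ≡ f′ →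
  innerVertices P f (c ++ m ∷ rest) ≡ innerVertices P f c ++ P′ ∷ innerVertices P′ f′ rest
  × endPoint P f (c ++ m ∷ rest) ≡ endPoint P′ f′ rest
lineFrom-join P f c m rest P′ f′ Ec refl refl = innerVertices-++ P f c m rest Ec , endPoint-++ P f c m rest Ec

det-advance : ∀ P f a → det (P ⊕ (a · f)) f ≡ det P f
det-advance (x , y) (f , f′) a = (x + a * f) * f′ - (y + a * f′) * f ≡ x * f′ - y * f ∋ solve (x ∷ y ∷ f ∷ f′ ∷ a ∷ [])

det-turn : ∀ Q f b → det Q (f ⊕ (b · Q)) ≡ det Q f
det-turn (x , y) (f , f′) b = x * (f′ + b * y) - y * (f + b * x) ≡ x * f′ - y * f ∋ solve (x ∷ y ∷ f ∷ f′ ∷ b ∷ [])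

det-⊕-·ʳ : ∀ P f a → det P (P ⊕ (a · f)) ≡ a * det P f
det-⊕-·ʳ (x , y) (f , f′) a = x * (y + a * f′) - y * (x + a * f) ≡ a * (x * f′ - y * f) ∋ solve (x ∷ y ∷ f ∷ f′ ∷ a ∷ [])

det-step : ∀ P f a b → det P f ≡ 1ℤ → det (P ⊕ (a · f)) (f ⊕ (b · (P ⊕ (a · f)))) ≡ 1ℤ
det-step P f a b Pf≡1 = trans (det-turn (P ⊕ (a · f)) f b) (trans (det-advance P f a) Pf≡1)

det-end : ∀ P f s → det P f ≡ 1ℤ → det (endPoint P f s) (endDirection P f s) ≡ 1ℤ
det-end P f [] Pf≡1 = Pf≡1
det-end P f (a ∷ []) Pf≡1 = trans (det-advance P f a) Pf≡1
det-end P f (a ∷ b ∷ s) Pf≡1 = det-end _ _ s (det-step P f a b Pf≡1)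

module Edge (P f : Point) (a : ℤ) (Pf≡1 : det P f ≡ 1ℤ) (0<a : 0ℤ < a) where

  Q : Point
  Q = P ⊕ (a · f)

  Q⊖P : Q ⊖ P ≡ a · f
  Q⊖P = cong₂ _,_ (shift (proj₁ P) (proj₁ f)) (shift (proj₂ P) (proj₂ f))
    where
    shift : ∀ x f → x + a * f - x ≡ a * f
    shift x f = solve (x ∷ f ∷ a ∷ [])

  P⊖Q : P ⊖ Q ≡ (- a) · f
  P⊖Q = cong₂ _,_ (shift (proj₁ P) (proj₁ f)) (shift (proj₂ P) (proj₂ f))
    where
    shift : ∀ x f → x - (x + a * f) ≡ - a * f
    shift x f = solve (x ∷ f ∷ a ∷ [])

  det-P-Q : det P Q ≡ a
  det-P-Q = trans (det-⊕-·ʳ P f a) (trans (cong (a *_) Pf≡1) (ℤP.*-identityʳ a))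

  lℓ-P-Q : + lℓ P Q ≡ a
  lℓ-P-Q = begin
    + gcdv (Q ⊖ P)    ≡⟨ cong (λ v → + gcdv v) Q⊖P ⟩
    + gcdv (a · f)    ≡⟨ cong +_ (gcdv-· a f) ⟩
    + (∣ a ∣ ℕ.* gcdv f) ≡⟨ cong (λ g → + (∣ a ∣ ℕ.* g)) (gcdv-unimodular P f Pf≡1) ⟩
    + (∣ a ∣ ℕ.* 1)   ≡⟨ cong +_ (ℕP.*-identityʳ _) ⟩
    + ∣ a ∣           ≡⟨ ℤP.0≤i⇒+∣i∣≡i (ℤP.<⇒≤ 0<a) ⟩
    a                 ∎
    where open ≡-Reasoning

  lℓ-Q-P : + lℓ Q P ≡ a
  lℓ-Q-P = trans (cong (λ v → + gcdv v) (neg-⊖ P Q)) (trans (cong +_ (gcdv-neg (Q ⊖ P))) lℓ-P-Q)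

  sgn-P-O-Q : sgn P O Q ≡ 1ℤ
  sgn-P-O-Q = trans (cong sgnℤ (cong₂ det (⊖-O P) (⊖-O Q))) (sgn-pos (subst (0ℤ <_) (sym det-P-Q) 0<a))

  signedLength : sgn P O Q * + lℓ P Q ≡ a
  signedLength = trans (cong₂ _*_ sgn-P-O-Q lℓ-P-Q) (ℤP.*-identityˡ a)

  unitDistance : ∣ det (prim (Q ⊖ P)) (O ⊖ P) ∣ ≡ 1
  unitDistance = cong ∣_∣ (*-cancel-pos _ _ 0<a (begin
    a * det (prim (Q ⊖ P)) (O ⊖ P)              ≡⟨ cong (_* det (prim (Q ⊖ P)) (O ⊖ P)) (sym lℓ-P-Q) ⟩
    + gcdv (Q ⊖ P) * det (prim (Q ⊖ P)) (O ⊖ P) ≡⟨ det-primˡ (Q ⊖ P) (O ⊖ P) ⟩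
    det (Q ⊖ P) (O ⊖ P)                         ≡⟨ cong₂ det Q⊖P (O-⊖ P) ⟩
    det (a · f) (neg P)                         ≡⟨ det-·ˡ a f (neg P) ⟩
    a * det f (neg P)                           ≡⟨ cong (a *_) (trans (det-negʳ f P) (sym (det-antisym P f))) ⟩
    a * det P f                                 ≡⟨ cong (a *_) Pf≡1 ⟩
    a * 1ℤ                                      ∎))
    where open ≡-Reasoning

  P≢Q : P ≢ Q
  P≢Q P≡Q = ℤP.<-irrefl (sym (trans (sym det-P-Q) (trans (cong (det P) (sym P≡Q)) (det-self P)))) 0<a

module Turn (P f : Point) (a b c : ℤ) (Pf≡1 : det P f ≡ 1ℤ) (0<a : 0ℤ < a) (0<c : 0ℤ < c) where

  open Edge P f a Pf≡1 0<a using (Q; P⊖Q; lℓ-Q-P; sgn-P-O-Q)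

  f′ : Point
  f′ = f ⊕ (b · Q)

  open Edge Q f′ c (det-step P f a b Pf≡1) 0<c using () renaming (Q to R; Q⊖P to R⊖Q; lℓ-P-Q to lℓ-Q-R; sgn-P-O-Q to sgn-Q-O-R)

  det-f-f′ : det f f′ ≡ - b
  det-f-f′ = begin
    det f (f ⊕ (b · Q)) ≡⟨ expand Q f ⟩
    - (b * det Q f)     ≡⟨ cong (λ t → - (b * t)) (trans (det-advance P f a) Pf≡1) ⟩
    - (b * 1ℤ)          ≡⟨ cong -_ (ℤP.*-identityʳ b) ⟩
    - b                 ∎
    where
    open ≡-Reasoning
    expand : ∀ Q f → det f (f ⊕ (b · Q)) ≡ - (b * det Q f)
    expand (x , y) (f , f′) = f * (f′ + b * y) - f′ * (f + b * x) ≡ - (b * (x * f′ - y * f)) ∋ solve (x ∷ y ∷ f ∷ f′ ∷ b ∷ [])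

  det-PQ-RQ : det (P ⊖ Q) (R ⊖ Q) ≡ (a * c) * b
  det-PQ-RQ = begin
    det (P ⊖ Q) (R ⊖ Q)     ≡⟨ cong₂ det P⊖Q R⊖Q ⟩
    det ((- a) · f) (c · f′) ≡⟨ trans (det-·ˡ (- a) f _) (cong ((- a) *_) (det-·ʳ c f f′)) ⟩
    (- a) * (c * det f f′)  ≡⟨ cong (λ t → (- a) * (c * t)) det-f-f′ ⟩
    (- a) * (c * (- b))     ≡⟨ ((- a) * (c * (- b)) ≡ (a * c) * b ∋ solve (a ∷ b ∷ c ∷ [])) ⟩
    (a * c) * b             ∎
    where open ≡-Reasoning

  det-prims : det (prim (P ⊖ Q)) (prim (R ⊖ Q)) ≡ b
  det-prims = *-cancel-pos _ _ (0<* 0<a 0<c) (begin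
    (a * c) * det (prim (P ⊖ Q)) (prim (R ⊖ Q))
      ≡⟨ cong (_* det (prim (P ⊖ Q)) (prim (R ⊖ Q))) (sym (cong₂ _*_ lℓ-Q-P lℓ-Q-R)) ⟩
    (+ gcdv (P ⊖ Q) * + gcdv (R ⊖ Q)) * det (prim (P ⊖ Q)) (prim (R ⊖ Q))
      ≡⟨ det-prim-prim (P ⊖ Q) (R ⊖ Q) ⟩
    det (P ⊖ Q) (R ⊖ Q)
      ≡⟨ det-PQ-RQ ⟩
    (a * c) * b ∎)
    where open ≡-Reasoning

  signedSine : sgn P O Q * sgn Q O R * sgn P Q R * lsin P Q R ≡ b
  signedSine = begin
    sgn P O Q * sgn Q O R * sgn P Q R * lsin P Q R
      ≡⟨ cong₂ (λ s t → s * t * sgn P Q R * lsin P Q R) sgn-P-O-Q sgn-Q-O-R ⟩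
    1ℤ * 1ℤ * sgnℤ (det (P ⊖ Q) (R ⊖ Q)) * + ∣ det (prim (P ⊖ Q)) (prim (R ⊖ Q)) ∣
      ≡⟨ cong₂ (λ s t → 1ℤ * 1ℤ * sgnℤ s * + ∣ t ∣) det-PQ-RQ det-prims ⟩
    1ℤ * 1ℤ * sgnℤ ((a * c) * b) * + ∣ b ∣
      ≡⟨ cong (_* + ∣ b ∣) (ℤP.*-identityˡ (sgnℤ ((a * c) * b))) ⟩
    sgnℤ ((a * c) * b) * + ∣ b ∣
      ≡⟨ cong (_* + ∣ b ∣) (sgn-*-pos b (0<* 0<a 0<c)) ⟩
    sgnℤ b * + ∣ b ∣
      ≡⟨ sgn*abs b ⟩
    b ∎
    where open ≡-Reasoning

lsSeq-lineFrom : ∀ P f s → det P f ≡ 1ℤ → EdgesPositive s → lsSeq O (lineFrom P f s) ≡ s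
lsSeq-lineFrom P f (a ∷ []) Pf≡1 [ 0<a ] = cong (_∷ []) (Edge.signedLength P f a Pf≡1 0<a)
lsSeq-lineFrom P f (a ∷ b ∷ c ∷ []) Pf≡1 (0<a ∷⁺ [ 0<c ]) =
  cong₂ _∷_ (Edge.signedLength P f a Pf≡1 0<a) (cong₂ _∷_ (Turn.signedSine P f a b c Pf≡1 0<a 0<c)
    (lsSeq-lineFrom (P ⊕ (a · f)) (f ⊕ (b · (P ⊕ (a · f)))) (c ∷ []) (det-step P f a b Pf≡1) [ 0<c ]))
lsSeq-lineFrom P f (a ∷ b ∷ c ∷ d ∷ s) Pf≡1 (0<a ∷⁺ 0<c ∷⁺ Es) =
  cong₂ _∷_ (Edge.signedLength P f a Pf≡1 0<a) (cong₂ _∷_ (Turn.signedSine P f a b c Pf≡1 0<a 0<c)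
    (lsSeq-lineFrom (P ⊕ (a · f)) (f ⊕ (b · (P ⊕ (a · f)))) (c ∷ d ∷ s) (det-step P f a b Pf≡1) (0<c ∷⁺ Es)))

lineFrom-isBrokenLine : ∀ P f s → det P f ≡ 1ℤ → EdgesPositive s → IsBrokenLine O (lineFrom P f s)
lineFrom-isBrokenLine P f s Pf≡1 Es = two≤length , distinct P f s Pf≡1 Es , unit P f s Pf≡1 Es
  where
  two≤length : 2 ℕ.≤ length (lineFrom P f s)
  two≤length = ℕ.s≤s (subst (1 ℕ.≤_) (sym (trans (ListP.length-++ (innerVertices P f s)) (ℕP.+-comm _ 1))) (ℕ.s≤s ℕ.z≤n))
  distinct : ∀ P f s → det P f ≡ 1ℤ → EdgesPositive s → ConsecDistinct (lineFrom P f s)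
  distinct P f (a ∷ []) Pf≡1 [ 0<a ] = Edge.P≢Q P f a Pf≡1 0<a , tt
  distinct P f (a ∷ b ∷ s) Pf≡1 (0<a ∷⁺ Es) = Edge.P≢Q P f a Pf≡1 0<a , distinct _ _ s (det-step P f a b Pf≡1) Es
  unit : ∀ P f s → det P f ≡ 1ℤ → EdgesPositive s → UnitDist O (lineFrom P f s)
  unit P f (a ∷ []) Pf≡1 [ 0<a ] = Edge.unitDistance P f a Pf≡1 0<a , tt
  unit P f (a ∷ b ∷ s) Pf≡1 (0<a ∷⁺ Es) = Edge.unitDistance P f a Pf≡1 0<a , unit _ _ s (det-step P f a b Pf≡1) Es

-- Winding around the origin

Upper : Point → Set
Upper X = 0ℤ < proj₂ X

crossing-upper : ∀ P Q → Upper P → 0ℤ ≤ det P Q → crossing O P Q ≡ 0ℤ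
crossing-upper (x , y) (u , v) 0<y 0≤det
  rewrite ℤP.+-identityʳ x | ℤP.+-identityʳ y | ℤP.+-identityʳ u | ℤP.+-identityʳ v
  with y ≤ᵇ 0ℤ in y≤0
... | true = contradiction (ℤP.≤ᵇ⇒≤ (subst T (sym y≤0) tt)) (ℤP.<⇒≱ 0<y)
... | false with v ≤ᵇ 0ℤ
...   | false = refl
...   | true with x * v - y * u ≤ᵇ - 1ℤ in det≤-1
...     | false = refl
...     | true = contradiction 0≤det (ℤP.<⇒≱ (ℤP.≤-<-trans (ℤP.≤ᵇ⇒≤ (subst T (sym det≤-1) tt)) (-<+ {0} {0})))

crossing-start : ∀ a → 0ℤ < a → crossing O e₁ (e₁ ⊕ (a · e₂)) ≡ 1ℤ
crossing-start +[1+ n ] _ = refl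
crossing-start +0 (+<+ ())

wind-skip : ∀ P Q l → crossing O P Q ≡ 0ℤ → wind O (P ∷ Q ∷ l) ≡ wind O (Q ∷ l)
wind-skip P Q l cross≡0 = trans (cong (_+ wind O (Q ∷ l)) cross≡0) (ℤP.+-identityˡ _)

crossing-edge : ∀ P f a → det P f ≡ 1ℤ → 0ℤ < a → Upper P → crossing O P (P ⊕ (a · f)) ≡ 0ℤ
crossing-edge P f a Pf≡1 0<a up-P =
  crossing-upper P _ up-P (ℤP.<⇒≤ (subst (0ℤ <_) (sym (Edge.det-P-Q P f a Pf≡1 0<a)) 0<a))

wind-upper : ∀ P f s rest → det P f ≡ 1ℤ → EdgesPositive s → Upper P → All Upper (innerVertices P f s) →
  wind O (P ∷ (innerVertices P f s ++ endPoint P f s ∷ rest)) ≡ wind O (endPoint P f s ∷ rest)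
wind-upper P f (a ∷ []) rest Pf≡1 [ 0<a ] up-P _ = wind-skip P _ rest (crossing-edge P f a Pf≡1 0<a up-P)
wind-upper P f (a ∷ b ∷ s) rest Pf≡1 (0<a ∷⁺ Es) up-P (up-Q All.∷ ups) =
  trans (wind-skip P Q (innerVertices Q f′ s ++ endPoint Q f′ s ∷ rest) (crossing-edge P f a Pf≡1 0<a up-P))
        (wind-upper Q f′ s rest (det-step P f a b Pf≡1) Es up-Q ups)
  where
  Q f′ : Point
  Q = P ⊕ (a · f)
  f′ = f ⊕ (b · Q)

L₁ : List Point
L₁ = e₁ ∷ (1ℤ , 1ℤ) ∷ neg e₁ ∷ []

-- Only the first edge, leaving the positive x-axis upwards, and the last edge of reverse L₁ cross the
-- positive x-axis.
lineFrom-wind : ∀ s → EdgesPositive s → All Upper (innerVertices e₁ e₂ s) → endPoint e₁ e₂ s ≡ neg e₁ →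
  wind O (lineFrom e₁ e₂ s ++ reverse L₁) ≡ 0ℤ
lineFrom-wind (a ∷ []) [ 0<a ] _ end≡ = contradiction (subst (0ℤ <_) a≡0 0<a) (ℤP.<-irrefl refl)
  where
  a≡0 : a ≡ 0ℤ
  a≡0 = trans (sym (0ℤ + a * 1ℤ ≡ a ∋ solve (a ∷ []))) (cong proj₂ end≡)
lineFrom-wind (a ∷ b ∷ s) (0<a ∷⁺ Es) (up-Q All.∷ ups) end≡ = begin
  wind O (e₁ ∷ (Q ∷ (innerVertices Q f s ++ endPoint Q f s ∷ [])) ++ reverse L₁)
    ≡⟨ cong (λ l → wind O (e₁ ∷ Q ∷ l)) (ListP.++-assoc (innerVertices Q f s) (endPoint Q f s ∷ []) (reverse L₁)) ⟩
  crossing O e₁ Q + wind O (Q ∷ (innerVertices Q f s ++ endPoint Q f s ∷ reverse L₁))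
    ≡⟨ cong₂ _+_ (crossing-start a 0<a) (wind-upper Q f s (reverse L₁) (det-step e₁ e₂ a b refl) Es up-Q ups) ⟩
  1ℤ + wind O (endPoint Q f s ∷ reverse L₁)
    ≡⟨ cong (λ P → 1ℤ + wind O (P ∷ reverse L₁)) end≡ ⟩
  0ℤ ∎
  where
  open ≡-Reasoning
  Q f : Point
  Q = e₁ ⊕ (a · e₂)
  f = e₂ ⊕ (b · Q)

last-lineFrom : ∀ P f s → Data.List.last (lineFrom P f s) ≡ just (endPoint P f s)
last-lineFrom P f s = go P (innerVertices P f s)
  where
  go : ∀ P vs → Data.List.last (P ∷ (vs ++ endPoint _ _ s ∷ [])) ≡ just (endPoint _ _ s)
  go P [] = refl
  go P (Q ∷ vs) = go Q vs

identityMap : ProperAff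
identityMap = record { a = 1ℤ ; b = 0ℤ ; c = 0ℤ ; d = 1ℤ ; t₁ = 0ℤ ; t₂ = 0ℤ ; detOne = refl }

applyAff-identityMap : ∀ P → applyAff identityMap P ≡ P
applyAff-identityMap (x , y) = cong₂ _,_ (1ℤ * x + 0ℤ * y + 0ℤ ≡ x ∋ solve (x ∷ y ∷ []))
                                      (0ℤ * x + 1ℤ * y + 0ℤ ≡ y ∋ solve (x ∷ y ∷ []))

L₁-isL : IsL 1 L₁
L₁-isL = (ℕ.s≤s (ℕ.s≤s ℕ.z≤n) , ((λ ()) , (λ ()) , tt) , (refl , refl , tt)) , refl , refl

upperLine⇒SumIsπ : ∀ s → EdgesPositive s → All Upper (innerVertices e₁ e₂ s) → endPoint e₁ e₂ s ≡ neg e₁ →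
  SumIsKπ s 1
upperLine⇒SumIsπ s Es ups end≡ =
  O , lineFrom e₁ e₂ s , lineFrom-isBrokenLine e₁ e₂ s refl Es , lsSeq-lineFrom e₁ e₂ s refl Es ,
  L₁ , L₁-isL , identityMap , refl , subst (λ l → Equiv O l L₁) (sym map-identity)
    (refl , trans (last-lineFrom e₁ e₂ s) (cong just end≡) , lineFrom-wind s Es ups end≡)
  where
  map-identity : map (applyAff identityMap) (lineFrom e₁ e₂ s) ≡ lineFrom e₁ e₂ s
  map-identity = trans (ListP.map-cong applyAff-identityMap _) (ListP.map-id _)

-- Odd continued fractions and their sails

data OddCF : List ℤ → Set where
  [_]  : ∀ {a} → 1ℤ ≤ a → OddCF (a ∷ [])
  cons : ∀ {a b s} → 1ℤ ≤ a → 1ℤ ≤ b → OddCF s → OddCF (a ∷ b ∷ s)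

IsOddCF⇒OddCF : ∀ {c num den} → IsOddCF c num den → OddCF c
IsOddCF⇒OddCF {c} odd = go c (proj₁ (IsOddCF.oddLength odd)) (proj₂ (IsOddCF.oddLength odd)) (IsOddCF.positive odd)
  where
  go : ∀ c r → length c ≡ suc (2 ℕ.* r) → AllPos c → OddCF c
  go (a ∷ []) r _ (1≤a ∷ []) = [ 1≤a ]
  go (a ∷ b ∷ s) (suc r) len≡ (1≤a ∷ 1≤b ∷ ps) =
    cons 1≤a 1≤b (go s r (ℕP.suc-injective (ℕP.suc-injective (trans len≡ (cong suc (ℕP.+-suc (suc r) (r ℕ.+ 0)))))) ps)
  go (a ∷ b ∷ s) zero () _
  go [] r () _

OddCF⇒EdgesPositive : ∀ {c} → OddCF c → EdgesPositive c
OddCF⇒EdgesPositive [ 1≤a ] = [ 1≤⇒0< 1≤a ]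
OddCF⇒EdgesPositive (cons 1≤a _ C) = 1≤⇒0< 1≤a ∷⁺ OddCF⇒EdgesPositive C

InSector : Point → Point → Set
InSector F X = 1ℤ ≤ proj₁ X × 0ℤ ≤ proj₂ X × 0ℤ < det X F

record StandardSail (c : List ℤ) : Set where
  field
    q p a b       : ℤ
    endPoint≡     : endPoint e₁ e₂ c ≡ (q , p)
    endDirection≡ : endDirection e₁ e₂ c ≡ (a , b)
    cfEval≡       : cfEval c ≡ (p , q)
    1≤q           : 1ℤ ≤ q
    q≤p           : q ≤ p
    0≤a           : 0ℤ ≤ a
    a<q           : a < q
    0≤b           : 0ℤ ≤ b
    b≤p           : b ≤ p
    unimodular    : q * b - p * a ≡ 1ℤ
    sector        : All (InSector (q , p)) (e₁ ∷ innerVertices e₁ e₂ c)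
    upper         : All Upper (innerVertices e₁ e₂ c)

  1≤p : 1ℤ ≤ p
  1≤p = ℤP.≤-trans 1≤q q≤p

  0<p : 0ℤ < p
  0<p = 1≤⇒0< 1≤p

-- The sail of c₀ ∷ c₁ ∷ s is the image of the sail of s under the first step of the generation.
module SailStep (c₀ c₁ : ℤ) where

  Q f′ : Point
  Q = e₁ ⊕ (c₀ · e₂)
  f′ = e₂ ⊕ (c₁ · Q)

  W : Point → Point
  W = lin Q f′

  W-formula : ∀ x y → W (x , y) ≡ (x + c₁ * y , c₀ * (x + c₁ * y) + y)
  W-formula x y = cong₂ _,_
    (x * (1ℤ + c₀ * 0ℤ) + y * (0ℤ + c₁ * (1ℤ + c₀ * 0ℤ)) ≡ x + c₁ * y ∋ solve (c₀ ∷ c₁ ∷ x ∷ y ∷ []))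
    (x * (0ℤ + c₀ * 1ℤ) + y * (1ℤ + c₁ * (0ℤ + c₀ * 1ℤ)) ≡ c₀ * (x + c₁ * y) + y ∋ solve (c₀ ∷ c₁ ∷ x ∷ y ∷ []))

  det-W : ∀ X Y → det (W X) (W Y) ≡ det X Y
  det-W X Y = trans (det-lin Q f′ X Y) (trans (cong (det X Y *_) (det-step e₁ e₂ c₀ c₁ refl)) (ℤP.*-identityʳ _))

  vertices : ∀ s → e₁ ∷ innerVertices e₁ e₂ (c₀ ∷ c₁ ∷ s) ≡ e₁ ∷ map W (e₁ ∷ innerVertices e₁ e₂ s)
  vertices s = cong (e₁ ∷_) (cong₂ _∷_ (sym (lin-e₁ Q f′)) (innerVertices-lin Q f′ s))

cfEval-cons : ∀ c cs → cfEval (c ∷ cs) ≡ (c * proj₁ (cfEval cs) + proj₂ (cfEval cs) , proj₁ (cfEval cs))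
cfEval-cons c cs with cfEval cs
... | (p , q) = refl

standardSail : ∀ c → OddCF c → StandardSail c
standardSail (c₀ ∷ []) [ 1≤c₀ ] = record
  { q = 1ℤ ; p = c₀ ; a = 0ℤ ; b = 1ℤ
  ; endPoint≡ = cong₂ _,_ (1ℤ + c₀ * 0ℤ ≡ 1ℤ ∋ solve (c₀ ∷ [])) (0ℤ + c₀ * 1ℤ ≡ c₀ ∋ solve (c₀ ∷ []))
  ; endDirection≡ = refl
  ; cfEval≡ = cong (_, 1ℤ) (c₀ * 1ℤ + 0ℤ ≡ c₀ ∋ solve (c₀ ∷ []))
  ; 1≤q = ℤP.≤-refl
  ; q≤p = 1≤c₀
  ; 0≤a = ℤP.≤-refl
  ; a<q = +<+ (ℕ.s≤s ℕ.z≤n)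
  ; 0≤b = 0≤+n 1
  ; b≤p = 1≤c₀
  ; unimodular = 1ℤ * 1ℤ - c₀ * 0ℤ ≡ 1ℤ ∋ solve (c₀ ∷ [])
  ; sector = (ℤP.≤-refl , ℤP.≤-refl , subst (0ℤ <_) (sym (det-e₁ (1ℤ , c₀))) (1≤⇒0< 1≤c₀))
             All.∷ All.[]
  ; upper = All.[]
  }
standardSail (c₀ ∷ c₁ ∷ s) (cons 1≤c₀ 1≤c₁ C) = sail-cons 1≤c₀ 1≤c₁ (standardSail s C)
  where
  sail-cons : 1ℤ ≤ c₀ → 1ℤ ≤ c₁ → StandardSail s → StandardSail (c₀ ∷ c₁ ∷ s)
  sail-cons 1≤c₀ 1≤c₁ record { q = q′ ; p = p′ ; a = a′ ; b = b′ ; endPoint≡ = endPoint≡′ ; endDirection≡ = endDirection≡′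
                             ; cfEval≡ = cfEval≡′ ; 1≤q = 1≤q′ ; q≤p = q′≤p′ ; 0≤a = 0≤a′ ; a<q = a′<q′ ; 0≤b = 0≤b′
                             ; b≤p = b′≤p′ ; sector = sector′ } = record
    { q = q ; p = p ; a = a ; b = b
    ; endPoint≡ = endPoint≡
    ; endDirection≡ = endDirection≡
    ; cfEval≡ = cfEval≡
    ; 1≤q = 1≤q
    ; q≤p = q≤p
    ; 0≤a = 0≤a
    ; a<q = a<q
    ; 0≤b = 0≤+ (0≤* (1≤⇒0≤ 1≤c₀) 0≤a) 0≤b′
    ; b≤p = ≤-by (c₀ * (q - a) + (p′ - b′))
                 ((c₀ * (q′ + c₁ * p′) + p′) - (c₀ * (a′ + c₁ * b′) + b′) ≡ c₀ * ((q′ + c₁ * p′) - (a′ + c₁ * b′)) + (p′ - b′)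
                    ∋ solve (c₀ ∷ c₁ ∷ q′ ∷ p′ ∷ a′ ∷ b′ ∷ []))
                 (0≤+ (0≤* (1≤⇒0≤ 1≤c₀) (0≤-diff (ℤP.<⇒≤ a<q))) (0≤-diff b′≤p′))
    ; unimodular = trans (cong₂ det (sym endPoint≡) (sym endDirection≡)) (det-end e₁ e₂ (c₀ ∷ c₁ ∷ s) refl)
    ; sector = subst (All (InSector (q , p))) (sym (vertices s)) (sector-e₁ All.∷ AllP.map⁺ (All.map W-sector sector′))
    ; upper = subst (All Upper) (sym (cong (Data.List.drop 1) (vertices s))) (AllP.map⁺ (All.map W-upper sector′))
    }
    where
    open SailStep c₀ c₁
    q p a b : ℤ
    q = q′ + c₁ * p′
    p = c₀ * q + p′
    a = a′ + c₁ * b′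
    b = c₀ * a + b′
    1≤p′ : 1ℤ ≤ p′
    1≤p′ = ℤP.≤-trans 1≤q′ q′≤p′
    0≤c₁ : 0ℤ ≤ c₁
    0≤c₁ = 1≤⇒0≤ 1≤c₁
    endPoint≡ : endPoint e₁ e₂ (c₀ ∷ c₁ ∷ s) ≡ (q , p)
    endPoint≡ = trans (endPoint-lin Q f′ s) (trans (cong W endPoint≡′) (W-formula q′ p′))
    endDirection≡ : endDirection e₁ e₂ (c₀ ∷ c₁ ∷ s) ≡ (a , b)
    endDirection≡ = trans (endDirection-lin Q f′ s) (trans (cong W endDirection≡′) (W-formula a′ b′))
    cfEval≡ : cfEval (c₀ ∷ c₁ ∷ s) ≡ (p , q)
    cfEval≡ = begin
      cfEval (c₀ ∷ c₁ ∷ s)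
        ≡⟨ cfEval-cons c₀ (c₁ ∷ s) ⟩
      (c₀ * proj₁ (cfEval (c₁ ∷ s)) + proj₂ (cfEval (c₁ ∷ s)) , proj₁ (cfEval (c₁ ∷ s)))
        ≡⟨ cong (λ z → (c₀ * proj₁ z + proj₂ z , proj₁ z))
                (trans (cfEval-cons c₁ s) (cong (λ z → (c₁ * proj₁ z + proj₂ z , proj₁ z)) cfEval≡′)) ⟩
      (c₀ * (c₁ * p′ + q′) + p′ , c₁ * p′ + q′)
        ≡⟨ cong₂ _,_ (c₀ * (c₁ * p′ + q′) + p′ ≡ c₀ * (q′ + c₁ * p′) + p′ ∋ solve (c₀ ∷ c₁ ∷ q′ ∷ p′ ∷ []))
                     (c₁ * p′ + q′ ≡ q′ + c₁ * p′ ∋ solve (c₁ ∷ q′ ∷ p′ ∷ [])) ⟩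
      (p , q) ∎
      where open ≡-Reasoning
    1≤q : 1ℤ ≤ q
    1≤q = ≤-by ((q′ - 1ℤ) + c₁ * p′) (q′ + c₁ * p′ - 1ℤ ≡ (q′ - 1ℤ) + c₁ * p′ ∋ solve (q′ ∷ p′ ∷ c₁ ∷ []))
               (0≤+ (0≤-diff 1≤q′) (0≤* 0≤c₁ (1≤⇒0≤ 1≤p′)))
    q≤p : q ≤ p
    q≤p = ≤-by ((c₀ - 1ℤ) * q + p′) ((c₀ * (q′ + c₁ * p′) + p′) - (q′ + c₁ * p′) ≡ (c₀ - 1ℤ) * (q′ + c₁ * p′) + p′
                 ∋ solve (c₀ ∷ c₁ ∷ q′ ∷ p′ ∷ []))
               (0≤+ (0≤* (0≤-diff 1≤c₀) (1≤⇒0≤ 1≤q)) (1≤⇒0≤ 1≤p′))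
    0≤a : 0ℤ ≤ a
    0≤a = 0≤+ 0≤a′ (0≤* 0≤c₁ 0≤b′)
    a<q : a < q
    a<q = <-by ((q′ - a′ - 1ℤ) + c₁ * (p′ - b′))
               ((q′ + c₁ * p′) - (a′ + c₁ * b′) - 1ℤ ≡ (q′ - a′ - 1ℤ) + c₁ * (p′ - b′)
                  ∋ solve (q′ ∷ p′ ∷ a′ ∷ b′ ∷ c₁ ∷ []))
               (0≤+ (0≤-diff-1 a′<q′) (0≤* 0≤c₁ (0≤-diff b′≤p′)))
    sector-e₁ : InSector (q , p) e₁
    sector-e₁ = ℤP.≤-refl , ℤP.≤-refl
              , subst (0ℤ <_) (sym (det-e₁ (q , p))) (ℤP.<-≤-trans (1≤⇒0< 1≤q) q≤p)
    W-sector : ∀ {X} → InSector (q′ , p′) X → InSector (q , p) (W X)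
    W-sector {x , y} (1≤x , 0≤y , 0<det) =
        subst (λ z → 1ℤ ≤ proj₁ z) (sym (W-formula x y))
          (≤-by ((x - 1ℤ) + c₁ * y) (x + c₁ * y - 1ℤ ≡ (x - 1ℤ) + c₁ * y ∋ solve (x ∷ y ∷ c₁ ∷ []))
                (0≤+ (0≤-diff 1≤x) (0≤* 0≤c₁ 0≤y)))
      , subst (λ z → 0ℤ ≤ proj₂ z) (sym (W-formula x y))
          (0≤+ (0≤* (1≤⇒0≤ 1≤c₀) (0≤+ (1≤⇒0≤ 1≤x) (0≤* 0≤c₁ 0≤y))) 0≤y)
      , subst (0ℤ <_) (sym (trans (cong (det (W (x , y))) (sym (W-formula q′ p′))) (det-W (x , y) (q′ , p′)))) 0<det
    W-upper : ∀ {X} → InSector (q′ , p′) X → Upper (W X)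
    W-upper {x , y} (1≤x , 0≤y , _) = subst Upper (sym (W-formula x y))
      (<-by ((c₀ - 1ℤ) * (x + c₁ * y) + (x - 1ℤ) + c₁ * y + y)
            (c₀ * (x + c₁ * y) + y - 0ℤ - 1ℤ ≡ (c₀ - 1ℤ) * (x + c₁ * y) + (x - 1ℤ) + c₁ * y + y ∋ solve (c₀ ∷ c₁ ∷ x ∷ y ∷ []))
            (0≤+ (0≤+ (0≤+ (0≤* (0≤-diff 1≤c₀) (0≤+ (1≤⇒0≤ 1≤x) (0≤* 0≤c₁ 0≤y))) (0≤-diff 1≤x))
                      (0≤* 0≤c₁ 0≤y)) 0≤y))

sector-positive : ∀ {q p} a v w X → 0ℤ < p → InSector (q , p) X →
  0ℤ < det a v → 0ℤ ≤ det a (lin v w (q , p)) → 0ℤ < det a (lin v w X)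
sector-positive {q} {p} a v w (x , y) 0<p (_ , 0≤y , 0<xp-yq) 0<av 0≤aU =
  0<-cancel 0<p (subst (0ℤ <_) (sym p*≡) (0<-+ (0<* 0<xp-yq 0<av) (0≤* 0≤y 0≤aU)))
  where
  p*≡ : p * det a (lin v w (x , y)) ≡ (x * p - y * q) * det a v + y * det a (lin v w (q , p))
  p*≡ = begin
    p * det a (lin v w (x , y))                          ≡⟨ cong (p *_) (det-linʳ v w x y a) ⟩
    p * (x * det a v + y * det a w)                      ≡⟨ regroup p q x y (det a v) (det a w) ⟩
    (x * p - y * q) * det a v + y * (q * det a v + p * det a w)
      ≡⟨ cong (λ z → (x * p - y * q) * det a v + y * z) (sym (det-linʳ v w q p a)) ⟩
    (x * p - y * q) * det a v + y * det a (lin v w (q , p)) ∎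
    where
    open ≡-Reasoning
    regroup : ∀ p q x y A W → p * (x * A + y * W) ≡ (x * p - y * q) * A + y * (q * A + p * W)
    regroup = solve-∀

sail-positive : ∀ a v w {c} → OddCF c → 0ℤ < det a v → 0ℤ ≤ det a (endPoint v w c) →
  All (λ z → 0ℤ < det a z) (innerVertices v w c)
sail-positive a v w {c} C 0<av 0≤aU = subst (All (λ z → 0ℤ < det a z)) (sym (innerVertices-lin v w c))
  (AllP.map⁺ (All.map (λ {X} X∈ → sector-positive a v w X 0<p X∈ 0<av 0≤aU′) (All.tail sector)))
  where
  open StandardSail (standardSail c C) using (q; p; 0<p; endPoint≡; sector)
  0≤aU′ : 0ℤ ≤ det a (lin v w (q , p))
  0≤aU′ = subst (λ z → 0ℤ ≤ det a z) (trans (endPoint-lin v w c) (cong (lin v w) endPoint≡)) 0≤aU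

-- Angles in standard position

-- In the basis (prim (X ⊖ Y) , w) of the lattice, the angle ∠XYZ becomes the angle at O from e₁ to
-- the end point of the sail of c.
record AngleBasis (X Y Z : Point) (c : List ℤ) : Set where
  field
    w          : Point
    oddCF      : OddCF c
    secondRay  : prim (Z ⊖ Y) ≡ lin (prim (X ⊖ Y)) w (endPoint e₁ e₂ c)
    orientation : det (prim (X ⊖ Y)) w ≡ sgnℤ (det (prim (X ⊖ Y)) (prim (Z ⊖ Y)))

common-factor : ∀ {q p a b x₁ x₂} → q * b - p * a ≡ 1ℤ → p * x₁ ≡ x₂ * q →
  x₁ ≡ q * (x₁ * b - a * x₂) × x₂ ≡ p * (x₁ * b - a * x₂)
common-factor {q} {p} {a} {b} {x₁} {x₂} unimodular px₁≡x₂q =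
    trans (times-one x₁) (trans (x₁ * (q * b - p * a) ≡ q * (x₁ * b - a * x₂) + a * (x₂ * q - p * x₁)
                                   ∋ solve (q ∷ p ∷ a ∷ b ∷ x₁ ∷ x₂ ∷ []))
                                (vanish (q * (x₁ * b - a * x₂)) a))
  , trans (times-one x₂) (trans (x₂ * (q * b - p * a) ≡ p * (x₁ * b - a * x₂) + b * (x₂ * q - p * x₁)
                                   ∋ solve (q ∷ p ∷ a ∷ b ∷ x₁ ∷ x₂ ∷ []))
                                (vanish (p * (x₁ * b - a * x₂)) b))
  where
  times-one : ∀ t → t ≡ t * (q * b - p * a)
  times-one t = trans (sym (ℤP.*-identityʳ t)) (cong (t *_) (sym unimodular))
  vanish : ∀ t s → t + s * (x₂ * q - p * x₁) ≡ t
  vanish t s = trans (cong (λ z → t + s * (z - p * x₁)) (sym px₁≡x₂q))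
                     (t + s * (p * x₁ - p * x₁) ≡ t ∋ solve (t ∷ s ∷ p ∷ x₁ ∷ []))

angleBasis : ∀ X Y Z c → det (prim (X ⊖ Y)) (prim (Z ⊖ Y)) ≢ 0ℤ → AngleSeq X Y Z c → AngleBasis X Y Z c
angleBasis X Y Z c nondegenerate (D , x₁ , x₂ , isD , v₂≡ , odd) = record
  { w = w
  ; oddCF = C
  ; secondRay = secondRay
  ; orientation = IsD.onL isD
  }
  where
  v₁ v₂ w : Point
  v₁ = prim (X ⊖ Y)
  v₂ = prim (Z ⊖ Y)
  w = D ⊖ Y
  ε : ℤ
  ε = sgnℤ (det v₁ v₂)
  C : OddCF c
  C = IsOddCF⇒OddCF odd
  open StandardSail (standardSail c C)

  det≡x₂ε : det v₁ v₂ ≡ x₂ * ε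
  det≡x₂ε = trans (cong (det v₁) v₂≡) (trans (det-lin-coord₂ v₁ w x₁ x₂) (cong (x₂ *_) (IsD.onL isD)))

  0<x₂ : 0ℤ < x₂
  0<x₂ = subst (0ℤ <_) ε·det≡x₂ (0<sgn*self nondegenerate)
    where
    ε·det≡x₂ : ε * det v₁ v₂ ≡ x₂
    ε·det≡x₂ = begin
      ε * det v₁ v₂ ≡⟨ cong (ε *_) det≡x₂ε ⟩
      ε * (x₂ * ε)  ≡⟨ swap ε ⟩
      x₂ * (ε * ε)  ≡⟨ cong (x₂ *_) (sgn*sgn nondegenerate) ⟩
      x₂ * 1ℤ       ≡⟨ ℤP.*-identityʳ x₂ ⟩
      x₂            ∎
      where
      open ≡-Reasoning
      swap : ∀ ε → ε * (x₂ * ε) ≡ x₂ * (ε * ε)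
      swap ε = solve (ε ∷ x₂ ∷ [])

  -- x₂ / x₁ = p / q with q b - p a = 1, so (x₁ , x₂) = k (q , p); primitivity of v₂ and x₂ > 0 force k = 1.
  k : ℤ
  k = x₁ * b - a * x₂

  factors : x₁ ≡ q * k × x₂ ≡ p * k
  factors = common-factor {q} {p} {a} {b} unimodular (subst (λ z → proj₁ z * x₁ ≡ x₂ * proj₂ z) cfEval≡ (IsOddCF.value odd))

  v₂≡k·u : v₂ ≡ k · lin v₁ w (q , p)
  v₂≡k·u = trans v₂≡ (trans (cong₂ (λ s t → lin v₁ w (s , t)) (proj₁ factors) (proj₂ factors)) (lin-* v₁ w q p k))

  Z⊖Y≢O : Z ⊖ Y ≢ O
  Z⊖Y≢O Z⊖Y≡O = nondegenerate (trans (cong (λ z → det v₁ (prim z)) Z⊖Y≡O) (det-O v₁))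

  ∣k∣≡1 : ∣ k ∣ ≡ 1
  ∣k∣≡1 = ℕP.m*n≡1⇒m≡1 ∣ k ∣ (gcdv (lin v₁ w (q , p)))
    (trans (sym (gcdv-· k _)) (trans (cong gcdv (sym v₂≡k·u)) (gcdv-prim (Z ⊖ Y) Z⊖Y≢O)))

  k≡1 : k ≡ 1ℤ
  k≡1 = trans (sym (ℤP.0≤i⇒+∣i∣≡i (ℤP.<⇒≤ 0<k))) (cong +_ ∣k∣≡1)
    where
    0<k : 0ℤ < k
    0<k = 0<-cancel 0<p (subst (0ℤ <_) (proj₂ factors) 0<x₂)

  secondRay : v₂ ≡ lin v₁ w (endPoint e₁ e₂ c)
  secondRay = trans v₂≡k·u (trans (cong (_· lin v₁ w (q , p)) k≡1) (trans (1· _) (cong (lin v₁ w) (sym endPoint≡))))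

sail-end : ∀ {X Y Z c} (B : AngleBasis X Y Z c) → endPoint (prim (X ⊖ Y)) (AngleBasis.w B) c ≡ prim (Z ⊖ Y)
sail-end {X} {Y} {Z} {c} B = trans (endPoint-lin (prim (X ⊖ Y)) (AngleBasis.w B) c) (sym (AngleBasis.secondRay B))

-- Lattice points of a triangle

length-unique : ∀ {A : Set} {xs ys : List A} → Unique xs → Unique ys →
  (∀ {z} → z ∈ xs → z ∈ ys) → (∀ {z} → z ∈ ys → z ∈ xs) → length xs ≡ length ys
length-unique uxs uys to from = ↭-length (∼bag⇒↭ (unique∧set⇒bag uxs uys (mk⇔ to from)))

length-range : ∀ lo k → length (range lo k) ≡ k
length-range lo zero = refl
length-range lo (suc k) = cong suc (length-range (lo + 1ℤ) k)

range-lower : ∀ lo k → All (lo ≤_) (range lo k)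
range-lower lo zero = All.[]
range-lower lo (suc k) = ℤP.≤-refl All.∷ All.map (ℤP.≤-trans (ℤP.i≤i+j lo 1ℤ)) (range-lower (lo + 1ℤ) k)

range-upper : ∀ lo k {t} → t ∈ range lo k → t < lo + + k
range-upper lo (suc k) (here refl) = <-by (+ k) (cancel (+ k)) (0≤+n k)
  where
  cancel : ∀ k → lo + (1ℤ + k) - lo - 1ℤ ≡ k
  cancel k = solve (lo ∷ k ∷ [])
range-upper lo (suc k) (there t∈) = subst (_ <_) (ℤP.+-assoc lo 1ℤ (+ k)) (range-upper (lo + 1ℤ) k t∈)

∈-range : ∀ lo k {t} → lo ≤ t → t < lo + + k → t ∈ range lo k
∈-range lo zero lo≤t t<lo = contradiction (ℤP.≤-<-trans lo≤t (subst (_ <_) (ℤP.+-identityʳ lo) t<lo)) (ℤP.<-irrefl refl)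
∈-range lo (suc k) {t} lo≤t t<lo+k with t ℤ.≟ lo
... | yes refl = here refl
... | no t≢lo = there (∈-range (lo + 1ℤ) k
  (subst (_≤ t) (ℤP.+-comm 1ℤ lo) (ℤP.i<j⇒suc[i]≤j (ℤP.≤∧≢⇒< lo≤t (λ lo≡t → t≢lo (sym lo≡t)))))
  (subst (t <_) (sym (ℤP.+-assoc lo 1ℤ (+ k))) t<lo+k))

range-unique : ∀ lo k → Unique (range lo k)
range-unique lo zero = AllPairs.[]
range-unique lo (suc k) =
  All.map (λ 1+lo≤t → ℤP.<⇒≢ (ℤP.suc[i]≤j⇒i<j (subst (_≤ _) (ℤP.+-comm lo 1ℤ) 1+lo≤t))) (range-lower (lo + 1ℤ) k)
  AllPairs.∷ range-unique (lo + 1ℤ) k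

∈-range-interval : ∀ lo hi t → lo ≤ t → t ≤ hi → t ∈ range lo (suc ∣ hi - lo ∣)
∈-range-interval lo hi t lo≤t t≤hi = ∈-range lo _ lo≤t (subst (t <_) (sym length≡) (ℤP.≤-<-trans t≤hi hi<hi+1))
  where
  hi<hi+1 : hi < hi + 1ℤ
  hi<hi+1 = <-by 0ℤ (hi + 1ℤ - hi - 1ℤ ≡ 0ℤ ∋ solve (hi ∷ [])) ℤP.≤-refl
  length≡ : lo + + suc ∣ hi - lo ∣ ≡ hi + 1ℤ
  length≡ = trans (cong (λ d → lo + (1ℤ + d)) (ℤP.0≤i⇒+∣i∣≡i (0≤-diff (ℤP.≤-trans lo≤t t≤hi))))
                  (lo + (1ℤ + (hi - lo)) ≡ hi + 1ℤ ∋ solve (lo ∷ hi ∷ []))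

module Box (A B C : Point) where

  x₀ x₁ y₀ y₁ : ℤ
  x₀ = proj₁ A ⊓ proj₁ B ⊓ proj₁ C
  x₁ = proj₁ A ⊔ proj₁ B ⊔ proj₁ C
  y₀ = proj₂ A ⊓ proj₂ B ⊓ proj₂ C
  y₁ = proj₂ A ⊔ proj₂ B ⊔ proj₂ C

  column : ℤ → List Point
  column x = map (x ,_) (range y₀ (suc ∣ y₁ - y₀ ∣))

  box-unique : Unique (box A B C)
  box-unique = UniqueP.concat⁺ {xss = map column (range x₀ (suc ∣ x₁ - x₀ ∣))}
    (AllP.map⁺ (All.tabulate (λ {x} _ → UniqueP.map⁺ {f = x ,_} (cong proj₂) (range-unique y₀ _))))
    (AllPairsP.map⁺ {f = column} (AllPairs.map disjoint (range-unique x₀ _)))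
    where
    disjoint : ∀ {x x′} → x ≢ x′ → ∀ {P} → ¬ (P ∈ column x × P ∈ column x′)
    disjoint {x} {x′} x≢x′ (P∈ , P∈′) with ∈P.∈-map⁻ (x ,_) P∈ | ∈P.∈-map⁻ (x′ ,_) P∈′
    ... | _ , _ , P≡ | _ , _ , P≡′ = x≢x′ (trans (sym (cong proj₁ P≡)) (cong proj₁ P≡′))

  ∈-box : ∀ {x y} → x₀ ≤ x → x ≤ x₁ → y₀ ≤ y → y ≤ y₁ → (x , y) ∈ box A B C
  ∈-box {x} {y} x₀≤x x≤x₁ y₀≤y y≤y₁ = ∈P.∈-concatMap⁺ column
    (Any.map (λ { refl → ∈P.∈-map⁺ (x ,_) (∈-range-interval y₀ y₁ y y₀≤y y≤y₁) }) (∈-range-interval x₀ x₁ x x₀≤x x≤x₁))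

min₃≤ : ∀ a b c → (a ⊓ b ⊓ c ≤ a) × (a ⊓ b ⊓ c ≤ b) × (a ⊓ b ⊓ c ≤ c)
min₃≤ a b c = ℤP.≤-trans (ℤP.i⊓j≤i (a ⊓ b) c) (ℤP.i⊓j≤i a b)
            , ℤP.≤-trans (ℤP.i⊓j≤i (a ⊓ b) c) (ℤP.i⊓j≤j a b)
            , ℤP.i⊓j≤j (a ⊓ b) c

≤max₃ : ∀ a b c → (a ≤ a ⊔ b ⊔ c) × (b ≤ a ⊔ b ⊔ c) × (c ≤ a ⊔ b ⊔ c)
≤max₃ a b c = ℤP.≤-trans (ℤP.i≤i⊔j a b) (ℤP.i≤i⊔j (a ⊔ b) c)
            , ℤP.≤-trans (ℤP.i≤j⊔i a b) (ℤP.i≤i⊔j (a ⊔ b) c)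
            , ℤP.i≤j⊔i (a ⊔ b) c

convex-≤ : ∀ {k w₁ w₂ w₃ x₁ x₂ x₃ x M} → k * x ≡ w₁ * x₁ + w₂ * x₂ + w₃ * x₃ → k ≡ w₁ + w₂ + w₃ →
  0ℤ < k → 0ℤ ≤ w₁ → 0ℤ ≤ w₂ → 0ℤ ≤ w₃ → x₁ ≤ M × x₂ ≤ M × x₃ ≤ M → x ≤ M
convex-≤ {k} {w₁} {w₂} {w₃} {x₁} {x₂} {x₃} {x} {M} kx≡ k≡ 0<k 0≤w₁ 0≤w₂ 0≤w₃ (x₁≤M , x₂≤M , x₃≤M) =
  ℤP.0≤i-j⇒j≤i (0≤-cancel 0<k (subst (0ℤ ≤_) (sym k[M-x]≡)
    (0≤+ (0≤+ (0≤* 0≤w₁ (0≤-diff x₁≤M)) (0≤* 0≤w₂ (0≤-diff x₂≤M))) (0≤* 0≤w₃ (0≤-diff x₃≤M)))))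
  where
  k[M-x]≡ : k * (M - x) ≡ w₁ * (M - x₁) + w₂ * (M - x₂) + w₃ * (M - x₃)
  k[M-x]≡ = begin
    k * (M - x)                 ≡⟨ (k * (M - x) ≡ k * M - k * x ∋ solve (k ∷ M ∷ x ∷ [])) ⟩
    k * M - k * x               ≡⟨ cong₂ (λ s t → s * M - t) k≡ kx≡ ⟩
    (w₁ + w₂ + w₃) * M - (w₁ * x₁ + w₂ * x₂ + w₃ * x₃)
      ≡⟨ ((w₁ + w₂ + w₃) * M - (w₁ * x₁ + w₂ * x₂ + w₃ * x₃) ≡ w₁ * (M - x₁) + w₂ * (M - x₂) + w₃ * (M - x₃)
           ∋ solve (w₁ ∷ w₂ ∷ w₃ ∷ x₁ ∷ x₂ ∷ x₃ ∷ M ∷ [])) ⟩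
    w₁ * (M - x₁) + w₂ * (M - x₂) + w₃ * (M - x₃) ∎
    where open ≡-Reasoning

convex-≥ : ∀ {k w₁ w₂ w₃ x₁ x₂ x₃ x m} → k * x ≡ w₁ * x₁ + w₂ * x₂ + w₃ * x₃ → k ≡ w₁ + w₂ + w₃ →
  0ℤ < k → 0ℤ ≤ w₁ → 0ℤ ≤ w₂ → 0ℤ ≤ w₃ → m ≤ x₁ × m ≤ x₂ × m ≤ x₃ → m ≤ x
convex-≥ {k} {w₁} {w₂} {w₃} {x₁} {x₂} {x₃} {x} {m} kx≡ k≡ 0<k 0≤w₁ 0≤w₂ 0≤w₃ (m≤x₁ , m≤x₂ , m≤x₃) =
  ℤP.neg-cancel-≤ (convex-≤ {x₁ = - x₁} {x₂ = - x₂} {x₃ = - x₃} {x = - x} {M = - m} neg-kx≡ k≡ 0<k 0≤w₁ 0≤w₂ 0≤w₃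
                             (ℤP.neg-mono-≤ m≤x₁ , ℤP.neg-mono-≤ m≤x₂ , ℤP.neg-mono-≤ m≤x₃))
  where
  neg-kx≡ : k * (- x) ≡ w₁ * (- x₁) + w₂ * (- x₂) + w₃ * (- x₃)
  neg-kx≡ = begin
    k * (- x) ≡⟨ sym (ℤP.neg-distribʳ-* k x) ⟩
    - (k * x) ≡⟨ cong -_ kx≡ ⟩
    - (w₁ * x₁ + w₂ * x₂ + w₃ * x₃)
      ≡⟨ (- (w₁ * x₁ + w₂ * x₂ + w₃ * x₃) ≡ w₁ * (- x₁) + w₂ * (- x₂) + w₃ * (- x₃) ∋ solve (w₁ ∷ w₂ ∷ w₃ ∷ x₁ ∷ x₂ ∷ x₃ ∷ [])) ⟩
    w₁ * (- x₁) + w₂ * (- x₂) + w₃ * (- x₃) ∎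
    where open ≡-Reasoning

-- The three determinants of inTri are the barycentric weights of P (d₂ for A, d₃ for B, d₁ for C), scaled by Δ.
module Barycentric (A B C P : Point) where

  Δ d₁ d₂ d₃ : ℤ
  Δ = det (B ⊖ A) (C ⊖ A)
  d₁ = det (B ⊖ A) (P ⊖ A)
  d₂ = det (C ⊖ B) (P ⊖ B)
  d₃ = det (A ⊖ C) (P ⊖ C)

  module _ (σ : ℤ) where

    weights-sum : σ * Δ ≡ σ * d₂ + σ * d₃ + σ * d₁
    weights-sum = identity A B C P
      where
      identity : ∀ A B C P →
        σ * det (B ⊖ A) (C ⊖ A) ≡ σ * det (C ⊖ B) (P ⊖ B) + σ * det (A ⊖ C) (P ⊖ C) + σ * det (B ⊖ A) (P ⊖ A)
      identity (a , a′) (b , b′) (c , c′) (p , p′) =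
        σ * ((b - a) * (c′ - a′) - (b′ - a′) * (c - a))
          ≡ σ * ((c - b) * (p′ - b′) - (c′ - b′) * (p - b)) + σ * ((a - c) * (p′ - c′) - (a′ - c′) * (p - c))
            + σ * ((b - a) * (p′ - a′) - (b′ - a′) * (p - a))
          ∋ solve (a ∷ a′ ∷ b ∷ b′ ∷ c ∷ c′ ∷ p ∷ p′ ∷ σ ∷ [])

    weighted-x : σ * Δ * proj₁ P ≡ σ * d₂ * proj₁ A + σ * d₃ * proj₁ B + σ * d₁ * proj₁ C
    weighted-x = identity A B C P
      where
      identity : ∀ A B C P → σ * det (B ⊖ A) (C ⊖ A) * proj₁ P
        ≡ σ * det (C ⊖ B) (P ⊖ B) * proj₁ A + σ * det (A ⊖ C) (P ⊖ C) * proj₁ B + σ * det (B ⊖ A) (P ⊖ A) * proj₁ C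
      identity (a , a′) (b , b′) (c , c′) (p , p′) =
        σ * ((b - a) * (c′ - a′) - (b′ - a′) * (c - a)) * p
          ≡ σ * ((c - b) * (p′ - b′) - (c′ - b′) * (p - b)) * a + σ * ((a - c) * (p′ - c′) - (a′ - c′) * (p - c)) * b
            + σ * ((b - a) * (p′ - a′) - (b′ - a′) * (p - a)) * c
          ∋ solve (a ∷ a′ ∷ b ∷ b′ ∷ c ∷ c′ ∷ p ∷ p′ ∷ σ ∷ [])

    weighted-y : σ * Δ * proj₂ P ≡ σ * d₂ * proj₂ A + σ * d₃ * proj₂ B + σ * d₁ * proj₂ C
    weighted-y = identity A B C P
      where
      identity : ∀ A B C P → σ * det (B ⊖ A) (C ⊖ A) * proj₂ P
        ≡ σ * det (C ⊖ B) (P ⊖ B) * proj₂ A + σ * det (A ⊖ C) (P ⊖ C) * proj₂ B + σ * det (B ⊖ A) (P ⊖ A) * proj₂ C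
      identity (a , a′) (b , b′) (c , c′) (p , p′) =
        σ * ((b - a) * (c′ - a′) - (b′ - a′) * (c - a)) * p′
          ≡ σ * ((c - b) * (p′ - b′) - (c′ - b′) * (p - b)) * a′ + σ * ((a - c) * (p′ - c′) - (a′ - c′) * (p - c)) * b′
            + σ * ((b - a) * (p′ - a′) - (b′ - a′) * (p - a)) * c′
          ∋ solve (a ∷ a′ ∷ b ∷ b′ ∷ c ∷ c′ ∷ p ∷ p′ ∷ σ ∷ [])

    ∈box : 0ℤ < σ * Δ → 0ℤ ≤ σ * d₁ → 0ℤ ≤ σ * d₂ → 0ℤ ≤ σ * d₃ → P ∈ box A B C
    ∈box 0<σΔ 0≤σd₁ 0≤σd₂ 0≤σd₃ = Box.∈-box A B C
      (convex-≥ weighted-x weights-sum 0<σΔ 0≤σd₂ 0≤σd₃ 0≤σd₁ (min₃≤ (proj₁ A) (proj₁ B) (proj₁ C)))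
      (convex-≤ weighted-x weights-sum 0<σΔ 0≤σd₂ 0≤σd₃ 0≤σd₁ (≤max₃ (proj₁ A) (proj₁ B) (proj₁ C)))
      (convex-≥ weighted-y weights-sum 0<σΔ 0≤σd₂ 0≤σd₃ 0≤σd₁ (min₃≤ (proj₂ A) (proj₂ B) (proj₂ C)))
      (convex-≤ weighted-y weights-sum 0<σΔ 0≤σd₂ 0≤σd₃ 0≤σd₁ (≤max₃ (proj₂ A) (proj₂ B) (proj₂ C)))

    private
      0≤1*⇒0≤ : ∀ {d} → 0ℤ ≤ 1ℤ * d → 0ℤ ≤ d
      0≤1*⇒0≤ {d} = subst (0ℤ ≤_) (ℤP.*-identityˡ d)
      0≤-1*⇒≤0 : ∀ {d} → 0ℤ ≤ - 1ℤ * d → d ≤ 0ℤ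
      0≤-1*⇒≤0 {d} 0≤-d = ℤP.neg-cancel-≤ (subst (0ℤ ≤_) (ℤP.-1*i≡-i d) 0≤-d)
      ≤0⇒0≤-1* : ∀ {d} → d ≤ 0ℤ → 0ℤ ≤ - 1ℤ * d
      ≤0⇒0≤-1* {d} d≤0 = subst (0ℤ ≤_) (sym (ℤP.-1*i≡-i d)) (ℤP.neg-mono-≤ d≤0)
      ∧⁺ : ∀ x {y} → T x → T y → T (x ∧ y)
      ∧⁺ x tx ty = Equivalence.from (T-∧ {x}) (tx , ty)
      ∧⁻ : ∀ x {y} → T (x ∧ y) → T x × T y
      ∧⁻ x = Equivalence.to (T-∧ {x})
      ∨⁺ : ∀ x {y} → T x ⊎ T y → T (x ∨ y)
      ∨⁺ x = Equivalence.from (T-∨ {x})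
      ∨⁻ : ∀ x {y} → T (x ∨ y) → T x ⊎ T y
      ∨⁻ x = Equivalence.to (T-∨ {x})

    inTri⁺ : σ * σ ≡ 1ℤ → 0ℤ ≤ σ * d₁ → 0ℤ ≤ σ * d₂ → 0ℤ ≤ σ * d₃ → T (inTri A B C P)
    inTri⁺ σσ≡1 0≤σd₁ 0≤σd₂ 0≤σd₃ with unit-cases σ σσ≡1
    ... | inj₁ refl = ∨⁺ ((0ℤ ≤ᵇ d₁) ∧ (0ℤ ≤ᵇ d₂) ∧ (0ℤ ≤ᵇ d₃)) (inj₁
            (∧⁺ (0ℤ ≤ᵇ d₁) (ℤP.≤⇒≤ᵇ (0≤1*⇒0≤ 0≤σd₁)) (∧⁺ (0ℤ ≤ᵇ d₂) (ℤP.≤⇒≤ᵇ (0≤1*⇒0≤ 0≤σd₂)) (ℤP.≤⇒≤ᵇ (0≤1*⇒0≤ 0≤σd₃)))))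
    ... | inj₂ refl = ∨⁺ ((0ℤ ≤ᵇ d₁) ∧ (0ℤ ≤ᵇ d₂) ∧ (0ℤ ≤ᵇ d₃)) (inj₂
            (∧⁺ (d₁ ≤ᵇ 0ℤ) (ℤP.≤⇒≤ᵇ (0≤-1*⇒≤0 0≤σd₁)) (∧⁺ (d₂ ≤ᵇ 0ℤ) (ℤP.≤⇒≤ᵇ (0≤-1*⇒≤0 0≤σd₂)) (ℤP.≤⇒≤ᵇ (0≤-1*⇒≤0 0≤σd₃)))))

    inTri⁻ : σ * σ ≡ 1ℤ → 0ℤ < σ * d₁ → T (inTri A B C P) → 0ℤ ≤ σ * d₂ × 0ℤ ≤ σ * d₃
    inTri⁻ σσ≡1 0<σd₁ inside with unit-cases σ σσ≡1 | ∨⁻ ((0ℤ ≤ᵇ d₁) ∧ (0ℤ ≤ᵇ d₂) ∧ (0ℤ ≤ᵇ d₃)) inside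
    ... | inj₁ refl | inj₁ nonneg =
      let 0≤d₂ , 0≤d₃ = ∧⁻ (0ℤ ≤ᵇ d₂) (proj₂ (∧⁻ (0ℤ ≤ᵇ d₁) nonneg))
      in subst (0ℤ ≤_) (sym (ℤP.*-identityˡ d₂)) (ℤP.≤ᵇ⇒≤ 0≤d₂) , subst (0ℤ ≤_) (sym (ℤP.*-identityˡ d₃)) (ℤP.≤ᵇ⇒≤ 0≤d₃)
    ... | inj₁ refl | inj₂ nonpos =
      contradiction (ℤP.≤ᵇ⇒≤ (proj₁ (∧⁻ (d₁ ≤ᵇ 0ℤ) nonpos))) (ℤP.<⇒≱ (subst (0ℤ <_) (ℤP.*-identityˡ d₁) 0<σd₁))
    ... | inj₂ refl | inj₁ nonneg =
      contradiction (ℤP.≤ᵇ⇒≤ (proj₁ (∧⁻ (0ℤ ≤ᵇ d₁) nonneg)))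
                    (ℤP.<⇒≱ (ℤP.neg-cancel-< {0ℤ} {d₁} (subst (0ℤ <_) (ℤP.-1*i≡-i d₁) 0<σd₁)))
    ... | inj₂ refl | inj₂ nonpos =
      let d₂≤0 , d₃≤0 = ∧⁻ (d₂ ≤ᵇ 0ℤ) (proj₂ (∧⁻ (d₁ ≤ᵇ 0ℤ) nonpos))
      in ≤0⇒0≤-1* (ℤP.≤ᵇ⇒≤ d₂≤0) , ≤0⇒0≤-1* (ℤP.≤ᵇ⇒≤ d₃≤0)

-- Lattice points at lattice distance one from a side

-- For consecutive angles ∠XYZ and ∠YZX, write n = lℓ(YZ), (u , e) for the lattice basis with u along YZ
-- and e = -ε w′, and f for the end direction of the sail of ∠XYZ. The lattice points at lattice distance
-- one from YZ inside the triangle are Y + t u - ε e for t in an interval of length n - 1 + (u-coordinate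
-- of f), so the turn lℓ(YZ) - lℓ₁(YZ;X) - 1 takes f exactly to -w′ (junction).
module Junction (X Y Z : Point) (cY cZ : List ℤ) (nondegenerate : det (X ⊖ Y) (Z ⊖ Y) ≢ 0ℤ)
                (AY : AngleBasis X Y Z cY) (AZ : AngleBasis Y Z X cZ) where

  private
    module AY = AngleBasis AY
    module AZ = AngleBasis AZ
    module SY = StandardSail (standardSail cY AY.oddCF)
    module SZ = StandardSail (standardSail cZ AZ.oddCF)

  open SY using (q; p; a; b; 0<p)
  open SZ using () renaming (q to q′; p to p′)

  v₁ u w v₁′ u′ w′ : Point
  v₁ = prim (X ⊖ Y)
  u = prim (Z ⊖ Y)
  w = AY.w
  v₁′ = prim (Y ⊖ Z)
  u′ = prim (X ⊖ Z)
  w′ = AZ.w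

  n g g′ : ℕ
  n = gcdv (Z ⊖ Y)
  g = gcdv (X ⊖ Y)
  g′ = gcdv (X ⊖ Z)

  ε : ℤ
  ε = sgnℤ (det v₁ u)

  Z⊖Y≢O : Z ⊖ Y ≢ O
  Z⊖Y≢O Z⊖Y≡O = nondegenerate (trans (cong (det (X ⊖ Y)) Z⊖Y≡O) (det-O (X ⊖ Y)))

  X⊖Y≢O : X ⊖ Y ≢ O
  X⊖Y≢O X⊖Y≡O = nondegenerate (trans (cong (λ z → det z (Z ⊖ Y)) X⊖Y≡O) (trans (det-antisym O (Z ⊖ Y)) (cong -_ (det-O (Z ⊖ Y)))))

  X⊖Z≢O : X ⊖ Z ≢ O
  X⊖Z≢O X⊖Z≡O = nondegenerate (trans (sym (det-shiftˡ X Y Z))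
    (trans (cong (λ z → det z (Z ⊖ Y)) X⊖Z≡O) (trans (det-antisym O (Z ⊖ Y)) (cong -_ (det-O (Z ⊖ Y))))))

  Y⊖Z≢O : Y ⊖ Z ≢ O
  Y⊖Z≢O Y⊖Z≡O = Z⊖Y≢O (trans (neg-⊖ Z Y) (cong neg Y⊖Z≡O))

  0<n : 0ℤ < + n
  0<n = 0<gcdv (Z ⊖ Y) Z⊖Y≢O

  0<g : 0ℤ < + g
  0<g = 0<gcdv (X ⊖ Y) X⊖Y≢O

  0<g′ : 0ℤ < + g′
  0<g′ = 0<gcdv (X ⊖ Z) X⊖Z≢O

  ε≡sgnΔ : ε ≡ sgnℤ (det (X ⊖ Y) (Z ⊖ Y))
  ε≡sgnΔ = sgn-det-prim (X ⊖ Y) (Z ⊖ Y) X⊖Y≢O Z⊖Y≢O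

  εε≡1 : ε * ε ≡ 1ℤ
  εε≡1 = trans (cong (λ s → s * s) ε≡sgnΔ) (sgn*sgn nondegenerate)

  det-v₁′-w′ : det v₁′ w′ ≡ ε
  det-v₁′-w′ = trans AZ.orientation (trans (sgn-det-prim (Y ⊖ Z) (X ⊖ Z) Y⊖Z≢O X⊖Z≢O)
    (trans (cong sgnℤ (sym (det-cycle X Y Z))) (sym ε≡sgnΔ)))

  v₁′≡-u : v₁′ ≡ neg u
  v₁′≡-u = trans (cong prim (neg-⊖ Y Z)) (prim-neg (Z ⊖ Y) Z⊖Y≢O)

  e : Point
  e = (- ε) · w′

  det-u-w′ : det u w′ ≡ - ε
  det-u-w′ = trans (sym (ℤP.neg-involutive _))
    (cong -_ (trans (sym (det-negˡ u w′)) (trans (cong (λ z → det z w′) (sym v₁′≡-u)) det-v₁′-w′)))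

  det-u-e : det u e ≡ 1ℤ
  det-u-e = trans (det-·ʳ (- ε) u w′) (trans (cong ((- ε) *_) det-u-w′) (trans (neg*neg ε) εε≡1))
    where
    neg*neg : ∀ x → (- x) * (- x) ≡ x * x
    neg*neg = solve-∀

  u≡ : u ≡ lin v₁ w (q , p)
  u≡ = trans AY.secondRay (cong (lin v₁ w) SY.endPoint≡)

  u′≡ : u′ ≡ lin v₁′ w′ (q′ , p′)
  u′≡ = trans AZ.secondRay (cong (lin v₁′ w′) SZ.endPoint≡)

  τ₁ : ℤ
  τ₁ = det v₁ e

  det-u-v₁ : det u v₁ ≡ - (p * ε)
  det-u-v₁ = begin
    det u v₁                          ≡⟨ cong (λ z → det z v₁) u≡ ⟩
    det (lin v₁ w (q , p)) v₁         ≡⟨ det-linˡ v₁ w q p v₁ ⟩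
    q * det v₁ v₁ + p * det w v₁
      ≡⟨ cong₂ (λ s t → q * s + p * t) (det-self v₁) (trans (det-antisym w v₁) (cong -_ AY.orientation)) ⟩
    q * 0ℤ + p * (- ε)                ≡⟨ simplify q p ε ⟩
    - (p * ε)                         ∎
    where
    open ≡-Reasoning
    simplify : ∀ q p ε → q * 0ℤ + p * (- ε) ≡ - (p * ε)
    simplify = solve-∀

  det-u-f : det u (lin v₁ w (a , b)) ≡ ε
  det-u-f = begin
    det u (lin v₁ w (a , b))          ≡⟨ det-linʳ v₁ w a b u ⟩
    a * det u v₁ + b * det u w
      ≡⟨ cong₂ (λ s t → a * s + b * t) det-u-v₁ (trans (cong (λ z → det z w) u≡) (det-lin-coord₁ v₁ w q p)) ⟩
    a * (- (p * ε)) + b * (q * (det v₁ w)) ≡⟨ cong (λ t → a * (- (p * ε)) + b * (q * t)) AY.orientation ⟩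
    a * (- (p * ε)) + b * (q * ε)     ≡⟨ regroup a b p q ε ⟩
    (q * b - p * a) * ε               ≡⟨ cong (_* ε) SY.unimodular ⟩
    1ℤ * ε                            ≡⟨ ℤP.*-identityˡ ε ⟩
    ε                                 ∎
    where
    open ≡-Reasoning
    regroup : ∀ a b p q ε → a * (- (p * ε)) + b * (q * ε) ≡ (q * b - p * a) * ε
    regroup = solve-∀

  τf : ℤ
  τf = det (lin v₁ w (a , b)) e

  p*τf : p * τf ≡ b - τ₁
  p*τf = begin
    p * τf                                ≡⟨ cong (p *_) (det-linˡ v₁ w a b e) ⟩
    p * (a * τ₁ + b * det w e)            ≡⟨ regroup p a τ₁ b (det w e) q ⟩
    (b - τ₁) + b * ((q * τ₁ + p * det w e) - 1ℤ) - τ₁ * ((q * b - p * a) - 1ℤ)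
      ≡⟨ cong₂ (λ s t → (b - τ₁) + b * (s - 1ℤ) - τ₁ * (t - 1ℤ)) q*τ₁+p*τw SY.unimodular ⟩
    (b - τ₁) + b * (1ℤ - 1ℤ) - τ₁ * (1ℤ - 1ℤ) ≡⟨ simplify b τ₁ ⟩
    b - τ₁                                ∎
    where
    open ≡-Reasoning
    q*τ₁+p*τw : q * τ₁ + p * det w e ≡ 1ℤ
    q*τ₁+p*τw = trans (sym (det-linˡ v₁ w q p e)) (trans (cong (λ z → det z e) (sym u≡)) det-u-e)
    regroup : ∀ p a τ₁ b τw q → p * (a * τ₁ + b * τw) ≡ (b - τ₁) + b * ((q * τ₁ + p * τw) - 1ℤ) - τ₁ * ((q * b - p * a) - 1ℤ)
    regroup = solve-∀
    simplify : ∀ b τ₁ → (b - τ₁) + b * (1ℤ - 1ℤ) - τ₁ * (1ℤ - 1ℤ) ≡ b - τ₁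
    simplify = solve-∀

  det-u′-e : det u′ e ≡ - q′
  det-u′-e = begin
    det u′ e                              ≡⟨ cong (λ z → det z e) u′≡ ⟩
    det (lin v₁′ w′ (q′ , p′)) e          ≡⟨ det-linˡ v₁′ w′ q′ p′ e ⟩
    q′ * det v₁′ e + p′ * det w′ e        ≡⟨ cong₂ (λ s t → q′ * s + p′ * t) det-v₁′-e det-w′-e ⟩
    q′ * (- 1ℤ) + p′ * 0ℤ                 ≡⟨ simplify q′ p′ ⟩
    - q′                                  ∎
    where
    open ≡-Reasoning
    det-v₁′-e : det v₁′ e ≡ - 1ℤ
    det-v₁′-e = trans (cong (λ z → det z e) v₁′≡-u) (trans (det-negˡ u e) (cong -_ det-u-e))
    det-w′-e : det w′ e ≡ 0ℤ
    det-w′-e = trans (det-·ʳ (- ε) w′ w′) (trans (cong ((- ε) *_) (det-self w′)) (ℤP.*-zeroʳ (- ε)))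
    simplify : ∀ q p → q * (- 1ℤ) + p * 0ℤ ≡ - q
    simplify = solve-∀

  det-u-u′ : det u u′ ≡ - (p′ * ε)
  det-u-u′ = begin
    det u u′                              ≡⟨ cong (det u) u′≡ ⟩
    det u (lin v₁′ w′ (q′ , p′))          ≡⟨ det-linʳ v₁′ w′ q′ p′ u ⟩
    q′ * det u v₁′ + p′ * det u w′        ≡⟨ cong₂ (λ s t → q′ * s + p′ * t) det-u-v₁′ det-u-w′ ⟩
    q′ * (- 0ℤ) + p′ * (- ε)              ≡⟨ simplify q′ p′ ε ⟩
    - (p′ * ε)                            ∎
    where
    open ≡-Reasoning
    det-u-v₁′ : det u v₁′ ≡ - 0ℤ
    det-u-v₁′ = trans (cong (det u) v₁′≡-u) (trans (det-negʳ u u) (cong -_ (det-self u)))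
    simplify : ∀ q p ε → q * (- 0ℤ) + p * (- ε) ≡ - (p * ε)
    simplify = solve-∀

  det-ZY-e : det (Z ⊖ Y) e ≡ + n
  det-ZY-e = trans (sym (det-primˡ (Z ⊖ Y) e)) (trans (cong (+ n *_) det-u-e) (ℤP.*-identityʳ _))

  det-u-ZY : det u (Z ⊖ Y) ≡ 0ℤ
  det-u-ZY = trans (sym (det-primʳ u (Z ⊖ Y))) (trans (cong (+ n *_) (det-self u)) (ℤP.*-zeroʳ (+ n)))

  -- The side XZ decomposes as XY + YZ; comparing coordinates relates the three side lengths.
  side-lengths-τ : + g′ * (- q′) ≡ + g * τ₁ - + n
  side-lengths-τ = begin
    + g′ * (- q′)                 ≡⟨ cong (+ g′ *_) (sym det-u′-e) ⟩
    + g′ * det u′ e               ≡⟨ det-primˡ (X ⊖ Z) e ⟩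
    det (X ⊖ Z) e                 ≡⟨ cong (λ z → det z e) (⊖-⊖ X Y Z) ⟩
    det ((X ⊖ Y) ⊖ (Z ⊖ Y)) e     ≡⟨ det-⊖ˡ (X ⊖ Y) (Z ⊖ Y) e ⟩
    det (X ⊖ Y) e - det (Z ⊖ Y) e ≡⟨ cong₂ _-_ (sym (det-primˡ (X ⊖ Y) e)) det-ZY-e ⟩
    + g * τ₁ - + n                ∎
    where open ≡-Reasoning

  side-lengths-η : + g′ * p′ ≡ + g * p
  side-lengths-η = *-cancel-unit _ _ εε≡1 (ℤP.neg-injective (begin
    - (+ g′ * p′ * ε)             ≡⟨ reassoc (+ g′) p′ ε ⟩
    + g′ * (- (p′ * ε))           ≡⟨ cong (+ g′ *_) (sym det-u-u′) ⟩
    + g′ * det u u′               ≡⟨ det-primʳ u (X ⊖ Z) ⟩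
    det u (X ⊖ Z)                 ≡⟨ cong (det u) (⊖-⊖ X Y Z) ⟩
    det u ((X ⊖ Y) ⊖ (Z ⊖ Y))     ≡⟨ det-⊖ʳ (X ⊖ Y) (Z ⊖ Y) u ⟩
    det u (X ⊖ Y) - det u (Z ⊖ Y) ≡⟨ cong₂ _-_ (sym (det-primʳ u (X ⊖ Y))) det-u-ZY ⟩
    + g * det u v₁ - 0ℤ           ≡⟨ ℤP.+-identityʳ _ ⟩
    + g * det u v₁                ≡⟨ cong (+ g *_) det-u-v₁ ⟩
    + g * (- (p * ε))             ≡⟨ sym (reassoc (+ g) p ε) ⟩
    - (+ g * p * ε)               ∎))
    where
    open ≡-Reasoning
    reassoc : ∀ g p ε → - (g * p * ε) ≡ g * (- (p * ε))
    reassoc = solve-∀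

  module Coordinates (P : Point) where

    τ η : ℤ
    τ = det (P ⊖ Y) e
    η = det u (P ⊖ Y)

    open Barycentric Y Z X P public using (d₁; d₂; d₃)

    d₁≡ : d₁ ≡ + n * η
    d₁≡ = sym (det-primˡ (Z ⊖ Y) (P ⊖ Y))

    d₃≡ : d₃ ≡ + g * (τ * (- (p * ε)) - η * τ₁)
    d₃≡ = begin
      det (Y ⊖ X) (P ⊖ X)             ≡⟨ det-cycle Y X P ⟩
      det (X ⊖ P) (Y ⊖ P)             ≡⟨ det-cycle X P Y ⟩
      det (P ⊖ Y) (X ⊖ Y)             ≡⟨ sym (det-primʳ (P ⊖ Y) (X ⊖ Y)) ⟩
      + g * det (P ⊖ Y) v₁            ≡⟨ cong (+ g *_) (plücker u e (P ⊖ Y) v₁ det-u-e) ⟩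
      + g * (τ * det u v₁ - η * τ₁)   ≡⟨ cong (λ z → + g * (τ * z - η * τ₁)) det-u-v₁ ⟩
      + g * (τ * (- (p * ε)) - η * τ₁) ∎
      where open ≡-Reasoning

    d₂≡ : d₂ ≡ + g′ * ((- q′) * η - (- (p′ * ε)) * (τ - + n))
    d₂≡ = begin
      det (X ⊖ Z) (P ⊖ Z)               ≡⟨ sym (det-primˡ (X ⊖ Z) (P ⊖ Z)) ⟩
      + g′ * det u′ (P ⊖ Z)             ≡⟨ cong (+ g′ *_) (plücker u e u′ (P ⊖ Z) det-u-e) ⟩
      + g′ * (det u′ e * det u (P ⊖ Z) - det u u′ * det (P ⊖ Z) e)
        ≡⟨ cong₂ (λ s t → + g′ * (s * det u (P ⊖ Z) - t * det (P ⊖ Z) e)) det-u′-e det-u-u′ ⟩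
      + g′ * ((- q′) * det u (P ⊖ Z) - (- (p′ * ε)) * det (P ⊖ Z) e)
        ≡⟨ cong₂ (λ s t → + g′ * ((- q′) * s - (- (p′ * ε)) * t)) η-PZ τ-PZ ⟩
      + g′ * ((- q′) * η - (- (p′ * ε)) * (τ - + n)) ∎
      where
      open ≡-Reasoning
      η-PZ : det u (P ⊖ Z) ≡ η
      η-PZ = trans (cong (det u) (⊖-⊖ P Y Z)) (trans (det-⊖ʳ (P ⊖ Y) (Z ⊖ Y) u)
               (trans (cong (λ t → η - t) det-u-ZY) (ℤP.+-identityʳ η)))
      τ-PZ : det (P ⊖ Z) e ≡ τ - + n
      τ-PZ = trans (cong (λ z → det z e) (⊖-⊖ P Y Z)) (trans (det-⊖ˡ (P ⊖ Y) (Z ⊖ Y) e) (cong (λ t → τ - t) det-ZY-e))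

    P≡ : P ≡ Y ⊕ ((τ · u) ⊕ (η · e))
    P≡ = trans (sym (⊖-⊕ Y P)) (cong (Y ⊕_) (cramer u e (P ⊖ Y) det-u-e))

  σ : ℤ
  σ = - ε

  σσ≡1 : σ * σ ≡ 1ℤ
  σσ≡1 = trans (neg*neg ε) εε≡1
    where
    neg*neg : ∀ x → (- x) * (- x) ≡ x * x
    neg*neg = solve-∀

  1≤b : 1ℤ ≤ b
  1≤b = ℤP.i<j⇒suc[i]≤j (0<-cancel (1≤⇒0< SY.1≤q) (subst (0ℤ <_) (sym qb≡) (0<-+ (+<+ (ℕ.s≤s ℕ.z≤n)) (0≤* (1≤⇒0≤ SY.1≤p) SY.0≤a))))
    where
    qb≡ : q * b ≡ 1ℤ + p * a
    qb≡ = trans (sym (shift (q * b) (p * a))) (cong (_+ p * a) SY.unimodular)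
      where
      shift : ∀ x y → x - y + y ≡ x
      shift = solve-∀

  lo Nℤ : ℤ
  lo = 1ℤ - τf
  Nℤ = + n - 1ℤ + τf

  0≤N : 0ℤ ≤ Nℤ
  0≤N = 0<-diff⇒≤ (0<-cancel (0<* 0<g 0<p) (subst (0ℤ <_) (sym gp[N+1]≡) 0<R))
    where
    R : ℤ
    R = + g * b + + n * (+ g * p - 1ℤ) + + g′ * q′
    0<R : 0ℤ < R
    0<R = 0<-+ (0<-+ (0<* 0<g (1≤⇒0< 1≤b)) (0≤* (0≤+n n) (0≤-diff (ℤP.i<j⇒suc[i]≤j (0<* 0<g 0<p)))))
               (0≤* (0≤+n g′) (1≤⇒0≤ SZ.1≤q))
    gp[N+1]≡ : + g * p * (Nℤ - 0ℤ + 1ℤ) ≡ R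
    gp[N+1]≡ = begin
      + g * p * (Nℤ - 0ℤ + 1ℤ)
        ≡⟨ expand (+ g) p (+ n) τf b τ₁ (+ g′) q′ ⟩
      R + + g * (p * τf - (b - τ₁)) - ((+ g * τ₁ - + n) - + g′ * (- q′))
        ≡⟨ cong₂ (λ s t → R + + g * s - t) (ℤP.i≡j⇒i-j≡0 p*τf) (ℤP.i≡j⇒i-j≡0 (sym side-lengths-τ)) ⟩
      R + + g * 0ℤ - 0ℤ
        ≡⟨ drop R (+ g) ⟩
      R ∎
      where
      open ≡-Reasoning
      expand : ∀ g p n τf b τ₁ g′ q′ → g * p * ((n - 1ℤ + τf) - 0ℤ + 1ℤ)
             ≡ (g * b + n * (g * p - 1ℤ) + g′ * q′) + g * (p * τf - (b - τ₁)) - ((g * τ₁ - n) - g′ * (- q′))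
      expand = solve-∀
      drop : ∀ r g → r + g * 0ℤ - 0ℤ ≡ r
      drop = solve-∀

  N : ℕ
  N = ∣ Nℤ ∣

  +N≡Nℤ : + N ≡ Nℤ
  +N≡Nℤ = ℤP.0≤i⇒+∣i∣≡i 0≤N

  lo+N≡n : lo + + N ≡ + n
  lo+N≡n = trans (cong (λ z → lo + z) +N≡Nℤ) (cancel τf (+ n))
    where
    cancel : ∀ t n → 1ℤ - t + (n - 1ℤ + t) ≡ n
    cancel = solve-∀

  lower⇐ : ∀ t → lo ≤ t → 0ℤ ≤ p * t - τ₁
  lower⇐ t lo≤t = subst (0ℤ ≤_) (sym p*t-τ₁≡) (0≤+ (0≤* (1≤⇒0≤ SY.1≤p) (0≤-diff lo≤t)) (0≤-diff SY.b≤p))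
    where
    p*t-τ₁≡ : p * t - τ₁ ≡ p * (t - lo) + (p - b)
    p*t-τ₁≡ = begin
      p * t - τ₁                                            ≡⟨ expand p t τ₁ τf b ⟩
      p * (t - lo) + (p - b) + ((b - τ₁) - p * τf)          ≡⟨ cong (λ z → p * (t - lo) + (p - b) + z) (ℤP.i≡j⇒i-j≡0 (sym p*τf)) ⟩
      p * (t - lo) + (p - b) + 0ℤ                           ≡⟨ ℤP.+-identityʳ _ ⟩
      p * (t - lo) + (p - b)                                ∎
      where
      open ≡-Reasoning
      expand : ∀ p t τ₁ τf b → p * t - τ₁ ≡ p * (t - (1ℤ - τf)) + (p - b) + ((b - τ₁) - p * τf)
      expand = solve-∀

  lower⇒ : ∀ t → 0ℤ ≤ p * t - τ₁ → lo ≤ t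
  lower⇒ t 0≤pt-τ₁ = 0<-diff⇒≤ (0<-cancel 0<p (subst (0ℤ <_) (sym p[t-lo+1]≡) (0<-+ (1≤⇒0< 1≤b) 0≤pt-τ₁)))
    where
    p[t-lo+1]≡ : p * (t - lo + 1ℤ) ≡ b + (p * t - τ₁)
    p[t-lo+1]≡ = begin
      p * (t - lo + 1ℤ)                           ≡⟨ expand p t τf ⟩
      p * t + p * τf                              ≡⟨ cong (λ z → p * t + z) p*τf ⟩
      p * t + (b - τ₁)                            ≡⟨ regroup p t b τ₁ ⟩
      b + (p * t - τ₁)                            ∎
      where
      open ≡-Reasoning
      expand : ∀ p t τf → p * (t - (1ℤ - τf) + 1ℤ) ≡ p * t + p * τf
      expand = solve-∀
      regroup : ∀ p t b τ₁ → p * t + (b - τ₁) ≡ b + (p * t - τ₁)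
      regroup = solve-∀

  upper⇐ : ∀ t → t < + n → 0ℤ ≤ - (q′ + p′ * (t - + n))
  upper⇐ t t<n = subst (0ℤ ≤_) (expand p′ q′ t (+ n)) (0≤+ (0≤* (1≤⇒0≤ SZ.1≤p) (0≤-diff-1 t<n)) (0≤-diff SZ.q≤p))
    where
    expand : ∀ p q t n → p * (n - t - 1ℤ) + (p - q) ≡ - (q + p * (t - n))
    expand = solve-∀

  upper⇒ : ∀ t → 0ℤ ≤ - (q′ + p′ * (t - + n)) → t < + n
  upper⇒ t 0≤ = 0<-diff⇒< (0<-cancel (1≤⇒0< SZ.1≤p) (subst (0ℤ <_) (expand p′ q′ t (+ n)) (0<-+ (1≤⇒0< SZ.1≤q) 0≤)))
    where
    expand : ∀ p q t n → q + - (q + p * (t - n)) ≡ p * (n - t)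
    expand = solve-∀

  module OnLine (P : Point) (η≡σ : Coordinates.η P ≡ σ) where
    open Coordinates P

    σd₁≡ : σ * d₁ ≡ + n
    σd₁≡ = trans (cong (σ *_) (trans d₁≡ (cong (+ n *_) η≡σ))) (trans (swap σ (+ n)) (trans (cong (+ n *_) σσ≡1) (ℤP.*-identityʳ _)))
      where
      swap : ∀ σ n → σ * (n * σ) ≡ n * (σ * σ)
      swap = solve-∀

    σd₂≡ : σ * d₂ ≡ + g′ * (- (q′ + p′ * (τ - + n)))
    σd₂≡ = trans (cong (σ *_) (trans d₂≡ (cong (λ z → + g′ * ((- q′) * z - (- (p′ * ε)) * (τ - + n))) η≡σ)))
                 (trans (expand ε (+ g′) q′ p′ τ (+ n)) (trans (cong (+ g′ * (- (q′ + p′ * (τ - + n))) *_) εε≡1) (ℤP.*-identityʳ _)))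
      where
      expand : ∀ ε g q p τ n → (- ε) * (g * ((- q) * (- ε) - (- (p * ε)) * (τ - n))) ≡ g * (- (q + p * (τ - n))) * (ε * ε)
      expand = solve-∀

    σd₃≡ : σ * d₃ ≡ + g * (p * τ - τ₁)
    σd₃≡ = trans (cong (σ *_) (trans d₃≡ (cong (λ z → + g * (τ * (- (p * ε)) - z * τ₁)) η≡σ)))
                 (trans (expand ε (+ g) τ p τ₁) (trans (cong (+ g * (p * τ - τ₁) *_) εε≡1) (ℤP.*-identityʳ _)))
      where
      expand : ∀ ε g τ p s → (- ε) * (g * (τ * (- (p * ε)) - (- ε) * s)) ≡ g * (p * τ - s) * (ε * ε)
      expand = solve-∀

  -- On the other line, at distance one on the far side of YZ, the weights d₂ and d₃ cannot both be
  -- nonnegative: their sum is -n (1 + g p) after normalising by ε.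
  module OffLine (P : Point) (η≡ε : Coordinates.η P ≡ ε) where
    open Coordinates P

    εd₁≡ : ε * d₁ ≡ + n
    εd₁≡ = trans (cong (ε *_) (trans d₁≡ (cong (+ n *_) η≡ε))) (trans (swap ε (+ n)) (trans (cong (+ n *_) εε≡1) (ℤP.*-identityʳ _)))
      where
      swap : ∀ σ n → σ * (n * σ) ≡ n * (σ * σ)
      swap = solve-∀

    εd₂+εd₃≡ : ε * d₂ + ε * d₃ + (+ n + + g * p * + n) ≡ 0ℤ
    εd₂+εd₃≡ = begin
      ε * d₂ + ε * d₃ + (+ n + + g * p * + n)
        ≡⟨ cong₂ (λ s t → ε * s + ε * t + (+ n + + g * p * + n))
                 (trans d₂≡ (cong (λ z → + g′ * ((- q′) * z - (- (p′ * ε)) * (τ - + n))) η≡ε))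
                 (trans d₃≡ (cong (λ z → + g * (τ * (- (p * ε)) - z * τ₁)) η≡ε)) ⟩
      ε * (+ g′ * ((- q′) * ε - (- (p′ * ε)) * (τ - + n))) + ε * (+ g * (τ * (- (p * ε)) - ε * τ₁)) + (+ n + + g * p * + n)
        ≡⟨ expand ε (+ g′) q′ p′ τ (+ n) (+ g) p τ₁ ⟩
      (ε * ε) * ((+ g′ * p′ - + g * p) * (τ - + n) + ((+ g * τ₁ - + n) - + g′ * (- q′)) * (- 1ℤ))
        + (1ℤ - ε * ε) * (+ n + + g * p * + n)
        ≡⟨ cong₃ εε≡1 (ℤP.i≡j⇒i-j≡0 side-lengths-η) (ℤP.i≡j⇒i-j≡0 (sym side-lengths-τ)) ⟩
      1ℤ * (0ℤ * (τ - + n) + 0ℤ * (- 1ℤ)) + (1ℤ - 1ℤ) * (+ n + + g * p * + n)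
        ≡⟨ vanish (τ - + n) (+ n + + g * p * + n) ⟩
      0ℤ ∎
      where
      open ≡-Reasoning
      expand : ∀ ε g′ q′ p′ τ n g p s →
        ε * (g′ * ((- q′) * ε - (- (p′ * ε)) * (τ - n))) + ε * (g * (τ * (- (p * ε)) - ε * s)) + (n + g * p * n)
        ≡ (ε * ε) * ((g′ * p′ - g * p) * (τ - n) + ((g * s - n) - g′ * (- q′)) * (- 1ℤ)) + (1ℤ - ε * ε) * (n + g * p * n)
      expand = solve-∀
      vanish : ∀ x y → 1ℤ * (0ℤ * x + 0ℤ * (- 1ℤ)) + (1ℤ - 1ℤ) * y ≡ 0ℤ
      vanish = solve-∀
      cong₃ : ∀ {s s′ t t′ r r′} → s ≡ s′ → t ≡ t′ → r ≡ r′ →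
        s * (t * (τ - + n) + r * (- 1ℤ)) + (1ℤ - s) * (+ n + + g * p * + n)
        ≡ s′ * (t′ * (τ - + n) + r′ * (- 1ℤ)) + (1ℤ - s′) * (+ n + + g * p * + n)
      cong₃ refl refl refl = refl

    not-inTri : ¬ T (inTri Y Z X P)
    not-inTri inside = ℤP.<-irrefl (sym εd₂+εd₃≡)
      (ℤP.+-mono-≤-< (0≤+ (proj₁ 0≤εd₂×0≤εd₃) (proj₂ 0≤εd₂×0≤εd₃)) (0<-+ 0<n (0≤* (0≤* (0≤+n g) (1≤⇒0≤ SY.1≤p)) (0≤+n n))))
      where
      0≤εd₂×0≤εd₃ : 0ℤ ≤ ε * d₂ × 0ℤ ≤ ε * d₃
      0≤εd₂×0≤εd₃ = Barycentric.inTri⁻ Y Z X P ε εε≡1 (subst (0ℤ <_) (sym εd₁≡) 0<n) inside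

  0<σΔ : 0ℤ < σ * det (Z ⊖ Y) (X ⊖ Y)
  0<σΔ = subst (0ℤ <_) (sym σΔ≡) (0<* (0<* 0<n 0<g) 0<p)
    where
    σΔ≡ : σ * det (Z ⊖ Y) (X ⊖ Y) ≡ + n * + g * p
    σΔ≡ = begin
      σ * det (Z ⊖ Y) (X ⊖ Y)          ≡⟨ cong (σ *_) (sym (det-prim-prim (Z ⊖ Y) (X ⊖ Y))) ⟩
      σ * ((+ n * + g) * det u v₁)     ≡⟨ cong (λ z → σ * ((+ n * + g) * z)) det-u-v₁ ⟩
      (- ε) * ((+ n * + g) * (- (p * ε))) ≡⟨ expand ε (+ n * + g) p ⟩
      + n * + g * p * (ε * ε)          ≡⟨ cong (+ n * + g * p *_) εε≡1 ⟩
      + n * + g * p * 1ℤ               ≡⟨ ℤP.*-identityʳ _ ⟩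
      + n * + g * p                    ∎
      where
      open ≡-Reasoning
      expand : ∀ ε k p → (- ε) * (k * (- (p * ε))) ≡ k * p * (ε * ε)
      expand = solve-∀

  ∣σ∣≡1 : ∣ σ ∣ ≡ 1
  ∣σ∣≡1 = [ cong ∣_∣ , cong ∣_∣ ]′ (unit-cases σ σσ≡1)

  φ : ℤ → Point
  φ t = Y ⊕ lin u e (t , σ)

  τ-φ : ∀ t → Coordinates.τ (φ t) ≡ t
  τ-φ t = trans (cong (λ z → det z e) (⊕-⊖ Y (lin u e (t , σ))))
                (trans (det-linˡ u e t σ e) (trans (cong₂ (λ s r → t * s + σ * r) det-u-e (det-self e)) (simplify t σ)))
    where
    simplify : ∀ t σ → t * 1ℤ + σ * 0ℤ ≡ t
    simplify = solve-∀

  η-φ : ∀ t → Coordinates.η (φ t) ≡ σ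
  η-φ t = trans (cong (det u) (⊕-⊖ Y (lin u e (t , σ))))
                (trans (det-linʳ u e t σ u) (trans (cong₂ (λ s r → t * s + σ * r) (det-self u) det-u-e) (simplify t σ)))
    where
    simplify : ∀ t σ → t * 0ℤ + σ * 1ℤ ≡ σ
    simplify = solve-∀

  φ-injective : ∀ {t t′} → φ t ≡ φ t′ → t ≡ t′
  φ-injective {t} {t′} φt≡φt′ = trans (sym (τ-φ t)) (trans (cong (λ P → det (P ⊖ Y) e) φt≡φt′) (τ-φ t′))

  nearSide : Point → Bool
  nearSide P = inTri Y Z X P ∧ isOne (latDist Y Z P)

  φ-nearSide : ∀ {t} → t ∈ range lo N → φ t ∈ filterᵇ nearSide (box Y Z X)
  φ-nearSide {t} t∈ = ∈P.∈-filter⁺ (λ P → T? (nearSide P)) φt∈box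
    (Equivalence.from T-∧ (Barycentric.inTri⁺ Y Z X (φ t) σ σσ≡1 (ℤP.<⇒≤ 0<σd₁) 0≤σd₂ 0≤σd₃ , distance-one))
    where
    open Coordinates (φ t)
    open OnLine (φ t) (η-φ t)
    0<σd₁ : 0ℤ < σ * d₁
    0<σd₁ = subst (0ℤ <_) (sym σd₁≡) 0<n
    0≤σd₂ : 0ℤ ≤ σ * d₂
    0≤σd₂ = subst (0ℤ ≤_) (sym σd₂≡) (0≤* (0≤+n g′)
              (subst (λ z → 0ℤ ≤ - (q′ + p′ * (z - + n))) (sym (τ-φ t))
                (upper⇐ t (subst (t <_) lo+N≡n (range-upper lo N t∈)))))
    0≤σd₃ : 0ℤ ≤ σ * d₃
    0≤σd₃ = subst (0ℤ ≤_) (sym σd₃≡) (0≤* (0≤+n g)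
              (subst (λ z → 0ℤ ≤ p * z - τ₁) (sym (τ-φ t)) (lower⇐ t (All.lookup (range-lower lo N) t∈))))
    φt∈box : φ t ∈ box Y Z X
    φt∈box = Barycentric.∈box Y Z X (φ t) σ 0<σΔ (ℤP.<⇒≤ 0<σd₁) 0≤σd₂ 0≤σd₃
    distance-one : T (isOne (latDist Y Z (φ t)))
    distance-one = subst (λ k → T (isOne k)) (sym (trans (cong ∣_∣ (η-φ t)) ∣σ∣≡1)) tt

  isOne⇒≡1 : ∀ k → T (isOne k) → k ≡ 1
  isOne⇒≡1 (suc zero) _ = refl

  nearSide⇒φ : ∀ {P} → P ∈ filterᵇ nearSide (box Y Z X) → P ∈ map φ (range lo N)
  nearSide⇒φ {P} P∈ = [ on-line , (λ η≡ε → contradiction inside (OffLine.not-inTri P η≡ε)) ]′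
                        (∣∣≡1⇒±unit η (isOne⇒≡1 ∣ η ∣ distance-one) εε≡1)
    where
    open Coordinates P
    inside×distance-one : T (inTri Y Z X P) × T (isOne (latDist Y Z P))
    inside×distance-one = Equivalence.to T-∧ (proj₂ (∈P.∈-filter⁻ (λ P → T? (nearSide P)) {xs = box Y Z X} P∈))
    inside : T (inTri Y Z X P)
    inside = proj₁ inside×distance-one
    distance-one : T (isOne ∣ η ∣)
    distance-one = proj₂ inside×distance-one
    on-line : η ≡ σ → P ∈ map φ (range lo N)
    on-line η≡σ = subst (_∈ map φ (range lo N)) (sym P≡φτ) (∈P.∈-map⁺ φ τ∈)
      where
      open OnLine P η≡σ
      0≤σd₂×0≤σd₃ : 0ℤ ≤ σ * d₂ × 0ℤ ≤ σ * d₃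
      0≤σd₂×0≤σd₃ = Barycentric.inTri⁻ Y Z X P σ σσ≡1 (subst (0ℤ <_) (sym σd₁≡) 0<n) inside
      τ<n : τ < + n
      τ<n = upper⇒ τ (0≤-cancel 0<g′ (subst (0ℤ ≤_) σd₂≡ (proj₁ 0≤σd₂×0≤σd₃)))
      lo≤τ : lo ≤ τ
      lo≤τ = lower⇒ τ (0≤-cancel 0<g (subst (0ℤ ≤_) σd₃≡ (proj₂ 0≤σd₂×0≤σd₃)))
      τ∈ : τ ∈ range lo N
      τ∈ = ∈-range lo N lo≤τ (subst (τ <_) (sym lo+N≡n) τ<n)
      P≡φτ : P ≡ φ τ
      P≡φτ = trans P≡ (cong (λ z → Y ⊕ ((τ · u) ⊕ (z · e))) η≡σ)

  φ⇒nearSide : ∀ {P} → P ∈ map φ (range lo N) → P ∈ filterᵇ nearSide (box Y Z X)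
  φ⇒nearSide P∈ with ∈P.∈-map⁻ φ P∈
  ... | t , t∈ , refl = φ-nearSide t∈

  lℓ₁≡N : + lℓ₁ Y Z X ≡ Nℤ
  lℓ₁≡N = trans (cong +_ length≡) +N≡Nℤ
    where
    length≡ : length (filterᵇ nearSide (box Y Z X)) ≡ N
    length≡ = trans (length-unique (UniqueP.filter⁺ (λ P → T? (nearSide P)) (Box.box-unique Y Z X))
                                   (UniqueP.map⁺ φ-injective (range-unique lo N)) nearSide⇒φ φ⇒nearSide)
                    (trans (ListP.length-map φ (range lo N)) (length-range lo N))

  junction : endDirection v₁ w cY ⊕ ((+ lℓ Y Z - + lℓ₁ Y Z X - 1ℤ) · u) ≡ neg w′
  junction = begin
    endDirection v₁ w cY ⊕ ((+ n - + lℓ₁ Y Z X - 1ℤ) · u)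
      ≡⟨ cong₂ (λ f m → f ⊕ (m · u)) f≡ m≡ ⟩
    ((τf · u) ⊕ (ε · e)) ⊕ ((- τf) · u)
      ≡⟨ cancel u w′ ⟩
    neg w′ ∎
    where
    open ≡-Reasoning
    f≡ : endDirection v₁ w cY ≡ (τf · u) ⊕ (ε · e)
    f≡ = trans (endDirection-lin v₁ w cY) (trans (cong (lin v₁ w) SY.endDirection≡)
           (trans (cramer u e (lin v₁ w (a , b)) det-u-e) (cong (λ z → (τf · u) ⊕ (z · e)) det-u-f)))
    m≡ : + n - + lℓ₁ Y Z X - 1ℤ ≡ - τf
    m≡ = trans (cong (λ k → + n - k - 1ℤ) lℓ₁≡N) (simplify (+ n) τf)
      where
      simplify : ∀ n t → n - (n - 1ℤ + t) - 1ℤ ≡ - t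
      simplify = solve-∀
    cancel : ∀ u w′ → ((τf · u) ⊕ (ε · ((- ε) · w′))) ⊕ ((- τf) · u) ≡ neg w′
    cancel (u , u′) (w , w′) = cong₂ _,_ (component u w) (component u′ w′)
      where
      component : ∀ u w → τf * u + ε * ((- ε) * w) + (- τf) * u ≡ - 1ℤ * w
      component u w = trans (expand τf ε u w) (cong (λ s → - s * w) εε≡1)
        where
        expand : ∀ t ε u w → t * u + ε * ((- ε) * w) + (- t) * u ≡ - (ε * ε) * w
        expand = solve-∀

-- The triangle

module Triangle (A B C : Point) (nondegenerate : det (B ⊖ A) (C ⊖ A) ≢ 0ℤ) (c₁ c₂ c₃ : List ℤ)
                (α : AngleSeq C A B c₁) (β : AngleSeq A B C c₂) (γ : AngleSeq B C A c₃) where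

  ndA : det (C ⊖ A) (B ⊖ A) ≢ 0ℤ
  ndA eq = nondegenerate (trans (det-antisym (B ⊖ A) (C ⊖ A)) (cong -_ eq))

  ndB : det (A ⊖ B) (C ⊖ B) ≢ 0ℤ
  ndB eq = ndA (trans (det-cycle C A B) eq)

  ndC : det (B ⊖ C) (A ⊖ C) ≢ 0ℤ
  ndC eq = ndB (trans (det-cycle A B C) eq)

  αB : AngleBasis C A B c₁
  αB = angleBasis C A B c₁ (det-prim-prim≢0 (C ⊖ A) (B ⊖ A) ndA) α
  βB : AngleBasis A B C c₂
  βB = angleBasis A B C c₂ (det-prim-prim≢0 (A ⊖ B) (C ⊖ B) ndB) β
  γB : AngleBasis B C A c₃
  γB = angleBasis B C A c₃ (det-prim-prim≢0 (B ⊖ C) (A ⊖ C) ndC) γ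

  module J₁ = Junction C A B c₁ c₂ ndA αB βB
  module J₂ = Junction A B C c₂ c₃ ndB βB γB

  m₁ m₂ : ℤ
  m₁ = + lℓ A B - + lℓ₁ A B C - 1ℤ
  m₂ = + lℓ B C - + lℓ₁ B C A - 1ℤ

  s : List ℤ
  s = c₁ ++ m₁ ∷ c₂ ++ m₂ ∷ c₃

  vA wA uA vB wB uB vC wC uC : Point
  vA = prim (C ⊖ A)
  wA = AngleBasis.w αB
  uA = prim (B ⊖ A)
  vB = prim (A ⊖ B)
  wB = AngleBasis.w βB
  uB = prim (C ⊖ B)
  vC = prim (B ⊖ C)
  wC = AngleBasis.w γB
  uC = prim (A ⊖ C)

  E₁ : EdgesPositive c₁
  E₁ = OddCF⇒EdgesPositive (AngleBasis.oddCF αB)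
  E₂ : EdgesPositive c₂
  E₂ = OddCF⇒EdgesPositive (AngleBasis.oddCF βB)
  E₃ : EdgesPositive c₃
  E₃ = OddCF⇒EdgesPositive (AngleBasis.oddCF γB)

  Es : EdgesPositive s
  Es = EdgesPositive-++ c₁ m₁ (c₂ ++ m₂ ∷ c₃) E₁ (EdgesPositive-++ c₂ m₂ c₃ E₂ E₃)

  uA≡-vB : uA ≡ neg vB
  uA≡-vB = trans (sym (neg-neg uA)) (cong neg (sym J₁.v₁′≡-u))

  -- After the sail of the angle at A the line follows the negated sail of the angle at B, then the sail at C.
  join₁ : innerVertices vA wA s ≡ innerVertices vA wA c₁ ++ uA ∷ innerVertices uA (neg wB) (c₂ ++ m₂ ∷ c₃)
        × endPoint vA wA s ≡ endPoint uA (neg wB) (c₂ ++ m₂ ∷ c₃)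
  join₁ = lineFrom-join vA wA c₁ m₁ (c₂ ++ m₂ ∷ c₃) uA (neg wB) E₁ (sail-end αB) J₁.junction

  endPoint₂ : endPoint uA (neg wB) c₂ ≡ vC
  endPoint₂ = begin
    endPoint uA (neg wB) c₂         ≡⟨ cong (λ P → endPoint P (neg wB) c₂) uA≡-vB ⟩
    endPoint (neg vB) (neg wB) c₂   ≡⟨ endPoint-linear neg neg-isLinear vB wB c₂ ⟩
    neg (endPoint vB wB c₂)         ≡⟨ cong neg (sail-end βB) ⟩
    neg uB                          ≡⟨ sym J₂.v₁′≡-u ⟩
    vC                              ∎
    where open ≡-Reasoning

  turn₂ : endDirection uA (neg wB) c₂ ⊕ (m₂ · vC) ≡ wC
  turn₂ = begin
    endDirection uA (neg wB) c₂ ⊕ (m₂ · vC)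
      ≡⟨ cong₂ (λ P v → endDirection P (neg wB) c₂ ⊕ (m₂ · v)) uA≡-vB J₂.v₁′≡-u ⟩
    endDirection (neg vB) (neg wB) c₂ ⊕ (m₂ · neg uB)
      ≡⟨ cong (_⊕ (m₂ · neg uB)) (endDirection-linear neg neg-isLinear vB wB c₂) ⟩
    neg (endDirection vB wB c₂) ⊕ (m₂ · neg uB)
      ≡⟨ sym (neg-isLinear (endDirection vB wB c₂) uB m₂) ⟩
    neg (endDirection vB wB c₂ ⊕ (m₂ · uB))
      ≡⟨ cong neg J₂.junction ⟩
    neg (neg wC)
      ≡⟨ neg-neg wC ⟩
    wC ∎
    where open ≡-Reasoning

  join₂ : innerVertices uA (neg wB) (c₂ ++ m₂ ∷ c₃) ≡ innerVertices uA (neg wB) c₂ ++ vC ∷ innerVertices vC wC c₃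
        × endPoint uA (neg wB) (c₂ ++ m₂ ∷ c₃) ≡ endPoint vC wC c₃
  join₂ = lineFrom-join uA (neg wB) c₂ m₂ c₃ vC wC E₂ endPoint₂ turn₂

  uC≡-vA : uC ≡ neg vA
  uC≡-vA = trans (cong prim (neg-⊖ A C)) (prim-neg (C ⊖ A) J₁.X⊖Y≢O)

  line-end : endPoint vA wA s ≡ neg vA
  line-end = trans (proj₂ join₁) (trans (proj₂ join₂) (trans (sail-end γB) uC≡-vA))

  -- 0 < det a z says that z lies strictly on the side of the line ℝ vA that contains uA.
  ε : ℤ
  ε = J₁.ε

  a : Point
  a = ε · vA

  det-a-lin : ∀ X → det a (lin vA wA X) ≡ proj₂ X
  det-a-lin (x , y) = begin
    det a (lin vA wA (x , y))        ≡⟨ det-·ˡ ε vA _ ⟩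
    ε * det vA (lin vA wA (x , y))   ≡⟨ cong (ε *_) (trans (det-lin-coord₂ vA wA x y) (cong (y *_) (AngleBasis.orientation αB))) ⟩
    ε * (y * ε)                      ≡⟨ swap ε y ⟩
    y * (ε * ε)                      ≡⟨ cong (y *_) J₁.εε≡1 ⟩
    y * 1ℤ                           ≡⟨ ℤP.*-identityʳ y ⟩
    y                                ∎
    where
    open ≡-Reasoning
    swap : ∀ ε y → ε * (y * ε) ≡ y * (ε * ε)
    swap = solve-∀

  0<det-a-uA : 0ℤ < det a uA
  0<det-a-uA = subst (0ℤ <_) (sym (det-·ˡ ε vA uA)) (0<sgn*self (det-prim-prim≢0 (C ⊖ A) (B ⊖ A) ndA))

  0<det-a-vC : 0ℤ < det a vC
  0<det-a-vC = subst (0ℤ <_) (sym (det-·ˡ ε vA vC)) (sgn≡⇒0<sgn* {det vA uA} same-sign (det-prim-prim≢0 (C ⊖ A) (B ⊖ C) nd))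
    where
    nd : det (C ⊖ A) (B ⊖ C) ≢ 0ℤ
    nd eq = ndA (trans (sym (det-shiftʳ C A B)) eq)
    same-sign : ε ≡ sgnℤ (det vA vC)
    same-sign = trans (sgn-det-prim (C ⊖ A) (B ⊖ A) J₁.X⊖Y≢O J₁.Z⊖Y≢O)
                      (trans (cong sgnℤ (sym (det-shiftʳ C A B))) (sym (sgn-det-prim (C ⊖ A) (B ⊖ C) J₁.X⊖Y≢O J₂.Y⊖Z≢O)))

  det-a-neg-vA≡0 : det a (neg vA) ≡ 0ℤ
  det-a-neg-vA≡0 = trans (det-·ˡ ε vA (neg vA)) (trans (cong (ε *_) (trans (det-negʳ vA vA) (cong -_ (det-self vA)))) (ℤP.*-zeroʳ ε))

  positive : All (λ z → 0ℤ < det a z) (innerVertices vA wA s)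
  positive = subst (All (λ z → 0ℤ < det a z))
    (sym (trans (proj₁ join₁) (cong (λ l → innerVertices vA wA c₁ ++ uA ∷ l) (proj₁ join₂))))
    (AllP.++⁺ sail-A (0<det-a-uA All.∷ AllP.++⁺ sail-B (0<det-a-vC All.∷ sail-C)))
    where
    sail-A : All (λ z → 0ℤ < det a z) (innerVertices vA wA c₁)
    sail-A = subst (All (λ z → 0ℤ < det a z)) (sym (innerVertices-lin vA wA c₁))
      (AllP.map⁺ (All.map (λ {X} 0<y → subst (0ℤ <_) (sym (det-a-lin X)) 0<y)
                          (StandardSail.upper (standardSail c₁ (AngleBasis.oddCF αB)))))
    sail-B : All (λ z → 0ℤ < det a z) (innerVertices uA (neg wB) c₂)
    sail-B = sail-positive a uA (neg wB) (AngleBasis.oddCF βB) 0<det-a-uA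
      (subst (λ z → 0ℤ ≤ det a z) (sym endPoint₂) (ℤP.<⇒≤ 0<det-a-vC))
    sail-C : All (λ z → 0ℤ < det a z) (innerVertices vC wC c₃)
    sail-C = sail-positive a vC wC (AngleBasis.oddCF γB) 0<det-a-vC
      (subst (λ z → 0ℤ ≤ det a z) (sym (trans (sail-end γB) uC≡-vA)) (subst (0ℤ ≤_) (sym det-a-neg-vA≡0) ℤP.≤-refl))

  standard-upper : All Upper (innerVertices e₁ e₂ s)
  standard-upper = All.map (λ {X} 0<aX → subst (0ℤ <_) (det-a-lin X) 0<aX)
    (AllP.map⁻ (subst (All (λ z → 0ℤ < det a z)) (innerVertices-lin vA wA s) positive))

  standard-end : endPoint e₁ e₂ s ≡ neg e₁
  standard-end = lin-injective vA wA (trans (cong (λ z → z * z) (AngleBasis.orientation αB)) J₁.εε≡1)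
    (trans (sym (endPoint-lin vA wA s)) (trans line-end (sym (lin-neg-e₁ vA wA))))

lemma4p4 : (A B C : Point) → det (B ⊖ A) (C ⊖ A) ≢ 0ℤ →
    (c₁ c₂ c₃ : List ℤ) →
    AngleSeq C A B c₁ → AngleSeq A B C c₂ → AngleSeq B C A c₃ →
    SumIsKπ (sum3 c₁ (+ lℓ A B - + lℓ₁ A B C - 1ℤ) c₂ (+ lℓ B C - + lℓ₁ B C A - 1ℤ) c₃) 1
lemma4p4 A B C nondegenerate c₁ c₂ c₃ α β γ = upperLine⇒SumIsπ s Es standard-upper standard-end
  where open Triangle A B C nondegenerate c₁ c₂ c₃ α β γ
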